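{- For every $n\ge1$ there is a bijection between the set of matchings on $[2n]$ that avoid the pattern $12312$ and the set of oscillating tableaux of length $2n$, $\emptyset=\lambda^0,\lambda^1,\dots,\lambda^{2n}=\emptyset$, such that every $\lambda^i$ is a partition of shape $(k)$ (for some $k\ge0$) or $(k,1)$ (for some $k\ge1$), and such that no partition $\lambda^i=(k,1)$ is immediately followed by $\lambda^{i+1}=(k+1,1)$.
   Context: An oscillating tableau of length $\ell$ is a sequence of partitions (Young diagrams) $\emptyset=\lambda^0,\lambda^1,\dots,\lambda^{\ell}=\emptyset$ such that each $\lambda^i$ is obtained from $\lambda^{i-1}$ by adding one square or removing one square. A matching on $[2n]$ is a partition of $[2n]$ into $n$ blocks of size two (edges). The canonical sequential form of a matching with $n$ edges is the word of length $2n$ obtained by labeling edges $1,\dots,n$ in increasing order of their smaller elements and writing at each position the label of the edge containing it. Words $a_1\cdots a_k$, $b_1\cdots b_k$ are order-isomorphic if $a_i<a_j\iff b_i<b_j$ for all $i,j$. A matching contains a pattern $\tau$ if its canonical sequential form has a subsequence order-isomorphic to $\tau$, and avoids $\tau$ otherwise. -}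

module Defs where

open import Data.Nat using (ℕ; zero; suc; _+_; _*_; _≤_; _<_; _≤ᵇ_; _<ᵇ_)
open import Data.Bool using (Bool; true; false; _∧_; if_then_else_)
open import Data.Fin using (Fin; toℕ; inject₁) renaming (suc to fsuc)
open import Data.Fin.Properties using ()
open import Data.List using (List; []; _∷_; length; allFin)
open import Data.Nat.ListAction using (sum)
open import Data.Vec using (Vec; lookup)
open import Data.Product using (Σ; ∃; _×_; _,_)
open import Data.Sum using (_⊎_)
open import Relation.Nullary using (¬_)
open import Relation.Binary.PropositionalEquality using (_≡_; _≢_)
open import Data.Refinement using (Refinement)

-- Matchings on [2n]
-- A matching on [2n] = {0,…,2n-1} (0-indexed) is encoded by its partner
-- map: position i is matched with position (partner i).

partnerOf : {m : ℕ} → Vec (Fin m) m → Fin m → Fin m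
partnerOf p i = lookup p i

IsMatching : {m : ℕ} → Vec (Fin m) m → Set
IsMatching {m} p =
  ((i : Fin m) → partnerOf p (partnerOf p i) ≡ i) ×
  ((i : Fin m) → partnerOf p i ≢ i)

opener : {m : ℕ} → Vec (Fin m) m → Fin m → Fin m
opener p i = if toℕ i ≤ᵇ toℕ (partnerOf p i) then i else partnerOf p i

countB : {A : Set} → (A → Bool) → List A → ℕ
countB f [] = 0
countB f (x ∷ xs) = if f x then suc (countB f xs) else countB f xs

-- Canonical sequential form: edges are labelled 1,…,n in increasing
-- order of their smaller elements; the letter at position i is the label
-- of the edge containing i, i.e. the number of edges whose smaller
-- element is ≤ the smaller element of the edge containing i.
canonicalForm : {m : ℕ} → Vec (Fin m) m → Fin m → ℕ
canonicalForm {m} p i =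
  countB (λ j → (toℕ j ≤ᵇ toℕ (opener p i)) ∧ (toℕ j <ᵇ toℕ (partnerOf p j)))
         (allFin m)

Contains : {m k : ℕ} → (Fin m → ℕ) → (Fin k → ℕ) → Set
Contains {m} {k} w τ =
  Σ (Fin k → Fin m) λ s →
    ((a b : Fin k) → toℕ a < toℕ b → toℕ (s a) < toℕ (s b)) ×
    ((a b : Fin k) → (w (s a) < w (s b) → τ a < τ b) × (τ a < τ b → w (s a) < w (s b)))

Avoids : {m k : ℕ} → (Fin m → ℕ) → (Fin k → ℕ) → Set
Avoids w τ = ¬ Contains w τ

pat12312 : Fin 5 → ℕ
pat12312 i = lookup (1 Data.Vec.∷ 2 Data.Vec.∷ 3 Data.Vec.∷ 1 Data.Vec.∷ 2 Data.Vec.∷ Data.Vec.[]) i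

-- Matchings on [2n] avoiding 12312 (proof-irrelevant refinement, so two
-- elements are equal iff their partner vectors are equal).
Avoiding12312 : ℕ → Set
Avoiding12312 n =
  Refinement (Vec (Fin (2 * n)) (2 * n))
    (λ p → IsMatching p × Avoids (canonicalForm p) pat12312)

data Decreasing : List ℕ → Set where
  []  : Decreasing []
  [_] : (a : ℕ) → Decreasing (a ∷ [])
  _∷_ : {a b : ℕ} {xs : List ℕ} → b ≤ a → Decreasing (b ∷ xs) → Decreasing (a ∷ b ∷ xs)

data AllPositive : List ℕ → Set where
  []  : AllPositive []
  _∷_ : {a : ℕ} {xs : List ℕ} → 0 < a → AllPositive xs → AllPositive (a ∷ xs)

IsPartition : List ℕ → Set
IsPartition λ′ = Decreasing λ′ × AllPositive λ′

part : List ℕ → ℕ → ℕ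
part [] i = 0
part (a ∷ xs) zero = a
part (a ∷ xs) (suc i) = part xs i

size : List ℕ → ℕ
size = sum

_⊆Y_ : List ℕ → List ℕ → Set
λ′ ⊆Y μ = (i : ℕ) → part λ′ i ≤ part μ i

AddsSquare : List ℕ → List ℕ → Set
AddsSquare λ′ μ = λ′ ⊆Y μ × size μ ≡ suc (size λ′)

OscStep : List ℕ → List ℕ → Set
OscStep λ′ μ = AddsSquare λ′ μ ⊎ AddsSquare μ λ′

IsOscillatingTableau : (ℓ : ℕ) → Vec (List ℕ) (suc ℓ) → Set
IsOscillatingTableau ℓ t =
  ((i : Fin (suc ℓ)) → IsPartition (lookup t i)) ×
  (lookup t Data.Fin.zero ≡ []) ×
  (lookup t (Data.Fin.fromℕ ℓ) ≡ []) ×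
  ((i : Fin ℓ) → OscStep (lookup t (inject₁ i)) (lookup t (fsuc i)))

RowOrHook : List ℕ → Set
RowOrHook λ′ =
  (λ′ ≡ []) ⊎ (∃ λ k → λ′ ≡ suc k ∷ []) ⊎ (∃ λ k → λ′ ≡ suc k ∷ 1 ∷ [])

NoHookGrowth : (ℓ : ℕ) → Vec (List ℕ) (suc ℓ) → Set
NoHookGrowth ℓ t =
  (i : Fin ℓ) (k : ℕ) → 1 ≤ k →
    lookup t (inject₁ i) ≡ k ∷ 1 ∷ [] → ¬ (lookup t (fsuc i) ≡ suc k ∷ 1 ∷ [])

RestrictedTableaux : ℕ → Set
RestrictedTableaux n =
  Refinement (Vec (List ℕ) (suc (2 * n)))
    (λ t → IsOscillatingTableau (2 * n) t ×
           ((i : Fin (suc (2 * n))) → RowOrHook (lookup t i)) ×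
           NoHookGrowth (2 * n) t)

-- Reading a matching on [m] from left to right, let s be the number of arcs open
-- between positions i - 1 and i. The tableau records λⁱ = (s), or the hook (s - 1 , 1)
-- when the next position i closes an arc crossed by an arc that is still open. A hook
-- is only formed before a closer, so it never grows; and a removal turns a row into a
-- hook only if the arc closed at i + 1 is crossed while the one closed at i is not,
-- which produces 12312. Conversely, a restricted tableau is decoded with a stack of
-- open positions: a step adding a square pushes i, a step removing one closes i with
-- the top of the stack, or with the entry below the top when λⁱ is a hook. In a
-- 12312-avoiding matching the arc closed at i is forced by λⁱ in the same way, since
-- two open arcs above its opener would form 12312; so decoding inverts the map.

module Submission where

open import Defs
open import Data.Bool using (Bool; true; false; T; _∧_)
open import Data.Bool.Properties using (T-∧; T-≡)
open import Data.Empty using (⊥; ⊥-elim)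
open import Data.Fin using (Fin; toℕ; fromℕ<; fromℕ; inject₁) renaming (zero to fzero; suc to fsuc)
open import Data.Fin.Properties using (toℕ<n; toℕ-fromℕ<; toℕ-fromℕ; toℕ-inject₁; toℕ-injective)
import Data.Fin.Properties as FinP
open import Data.Irrelevant using ([_])
open import Data.List using (List; []; _∷_; allFin; length)
import Data.List.Properties as ListP
open import Data.List.Membership.Propositional using (_∈_)
open import Data.List.Membership.Propositional.Properties using (∈-allFin)
open import Data.List.Relation.Unary.All as All using (All; []; _∷_)
open import Data.List.Relation.Unary.AllPairs as AllPairs using (AllPairs; []; _∷_)
open import Data.List.Relation.Unary.Any using (here; there)
open import Data.Nat using (ℕ; zero; suc; _+_; _*_; _∸_; _≤_; _<_; _>_; z≤n; s≤s; z<s; s<s; _<?_; _≤?_; _≤ᵇ_; _<ᵇ_)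
open import Data.Nat.Induction using (<-rec)
open import Data.Nat.Properties
open import Data.Product using (∃; ∃₂; _×_; _,_; proj₁; proj₂)
open import Data.Refinement as Refinement using (Refinement; _,_; value; value-injective)
open import Data.Sum using (_⊎_; inj₁; inj₂)
open import Data.Unit using (tt)
open import Data.Vec as Vec using (Vec; lookup; tabulate; []; _∷_)
import Data.Vec.Properties as VecP
open import Function using (_∘_; id; case_of_)
open import Function.Bundles using (Equivalence; _⤖_; mk⤖; mk⇔)
open import Relation.Binary.Definitions using (tri<; tri≈; tri>)
open import Relation.Binary.PropositionalEquality
open import Relation.Nullary using (¬_; ¬?; Dec; yes; no; does; proof; recompute; contradiction)
open import Relation.Nullary.Decidable using (_×-dec_; dec-true; dec-false; decidable-stable; does-⇔)
open import Relation.Nullary.Reflects using (Reflects; invert)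
open import Relation.Unary using (Decidable)


module _ {Q : ℕ → Set} (Q? : Decidable Q) where

  count : ℕ → ℕ
  count zero = 0
  count (suc k) with Q? k
  ... | yes _ = suc (count k)
  ... | no _ = count k

  count-none : ∀ k → (∀ y → y < k → ¬ Q y) → count k ≡ 0
  count-none zero none = refl
  count-none (suc k) none with Q? k
  ... | yes q = contradiction q (none k (n<1+n k))
  ... | no _ = count-none k (λ y y<k → none y (m<n⇒m<1+n y<k))

  count-positive : ∀ k x → x < k → Q x → 1 ≤ count k
  count-positive (suc k) x x<1+k q with Q? k
  ... | yes _ = s≤s z≤n
  ... | no ¬q with m<1+n⇒m<n∨m≡n x<1+k
  ...   | inj₁ x<k = count-positive k x x<k q
  ...   | inj₂ refl = contradiction q ¬q

count-cong : {Q R : ℕ → Set} (Q? : Decidable Q) (R? : Decidable R) (k : ℕ) →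
  (∀ y → y < k → Q y → R y) → (∀ y → y < k → R y → Q y) → count Q? k ≡ count R? k
count-cong Q? R? zero _ _ = refl
count-cong Q? R? (suc k) QR RQ with Q? k | R? k
... | yes _ | yes _ = cong suc (count-cong Q? R? k (λ y y<k → QR y (m<n⇒m<1+n y<k)) (λ y y<k → RQ y (m<n⇒m<1+n y<k)))
... | yes q | no ¬r = contradiction (QR k (n<1+n k) q) ¬r
... | no ¬q | yes r = contradiction (RQ k (n<1+n k) r) ¬q
... | no _ | no _ = count-cong Q? R? k (λ y y<k → QR y (m<n⇒m<1+n y<k)) (λ y y<k → RQ y (m<n⇒m<1+n y<k))

count-insert : {Q R : ℕ → Set} (Q? : Decidable Q) (R? : Decidable R) (k x : ℕ) → x < k → Q x → ¬ R x →
  (∀ y → y < k → y ≢ x → Q y → R y) → (∀ y → y < k → y ≢ x → R y → Q y) →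
  count Q? k ≡ suc (count R? k)
count-insert Q? R? (suc k) x x<1+k qx ¬rx QR RQ with x ≟ k
count-insert Q? R? (suc k) x x<1+k qx ¬rx QR RQ | yes refl with Q? x | R? x
... | yes _ | yes rx = contradiction rx ¬rx
... | yes _ | no _ = cong suc (count-cong Q? R? k (λ y y<k → QR y (m<n⇒m<1+n y<k) (<⇒≢ y<k)) (λ y y<k → RQ y (m<n⇒m<1+n y<k) (<⇒≢ y<k)))
... | no ¬qx | _ = contradiction qx ¬qx
count-insert Q? R? (suc k) x x<1+k qx ¬rx QR RQ | no x≢k with m<1+n⇒m<n∨m≡n x<1+k
... | inj₂ x≡k = contradiction x≡k x≢k
... | inj₁ x<k with Q? k | R? k
...   | yes _ | yes _ = cong suc (count-insert Q? R? k x x<k qx ¬rx (λ y y<k → QR y (m<n⇒m<1+n y<k)) (λ y y<k → RQ y (m<n⇒m<1+n y<k)))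
...   | yes q | no ¬r = contradiction (QR k (n<1+n k) (≢-sym x≢k) q) ¬r
...   | no ¬q | yes r = contradiction (RQ k (n<1+n k) (≢-sym x≢k) r) ¬q
...   | no _ | no _ = count-insert Q? R? k x x<k qx ¬rx (λ y y<k → QR y (m<n⇒m<1+n y<k)) (λ y y<k → RQ y (m<n⇒m<1+n y<k))

2≤count : {Q : ℕ → Set} (Q? : Decidable Q) (k x y : ℕ) → x < k → y < k → x ≢ y → Q x → Q y → 2 ≤ count Q? k
2≤count {Q} Q? k x y x<k y<k x≢y qx qy =
  subst (2 ≤_) (sym count-split) (s≤s (count-positive Q∖x? k y y<k (qy , ≢-sym x≢y)))
  where
  Q∖x : ℕ → Set
  Q∖x z = Q z × z ≢ x
  Q∖x? : Decidable Q∖x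
  Q∖x? z = Q? z ×-dec (¬? (z ≟ x))
  count-split : count Q? k ≡ suc (count Q∖x? k)
  count-split = count-insert Q? Q∖x? k x x<k qx (λ r → proj₂ r refl) (λ z _ z≢x q → q , z≢x) (λ z _ _ r → proj₁ r)

record IsMatchingOn (m : ℕ) (P : ℕ → ℕ) : Set where
  field
    partner<m     : ∀ x → x < m → P x < m
    involutive    : ∀ x → x < m → P (P x) ≡ x
    fixpoint-free : ∀ x → x < m → P x ≢ x

  partner-sym : ∀ {x y} → x < m → P x ≡ y → P y ≡ x
  partner-sym x<m refl = involutive _ x<m

  closer⇒partner< : ∀ i → i < m → ¬ (i < P i) → P i < i
  closer⇒partner< i i<m ¬opens = ≤∧≢⇒< (≮⇒≥ ¬opens) (fixpoint-free i i<m)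

-- x₃ is the opener of the arc carrying the letter 3: wherever that letter
-- sits, its opener lies strictly between x₂ and x₄.
record Occurrence12312 (m : ℕ) (P : ℕ → ℕ) : Set where
  constructor occurrence
  field
    x₁ x₂ x₃ x₄ x₅ : ℕ
    x₁<x₂ : x₁ < x₂
    x₂<x₃ : x₂ < x₃
    x₃<x₄ : x₃ < x₄
    x₄<x₅ : x₄ < x₅
    x₅<m  : x₅ < m
    arc₁₄ : P x₁ ≡ x₄
    arc₂₅ : P x₂ ≡ x₅
    x₃-opens : x₃ < P x₃

-- The row (k + 1) or, with the flag set, the hook (k , 1). For size 1 the flag gives
-- the junk shape (0 , 1), which HookFits excludes.
shape : ℕ → Bool → List ℕ
shape zero _ = []
shape (suc k) false = suc k ∷ []
shape (suc k) true = k ∷ 1 ∷ []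

HookFits : ℕ → Bool → Set
HookFits a b = b ≡ true → 2 ≤ a

shape-size : ∀ a b → size (shape a b) ≡ a
shape-size zero b = refl
shape-size (suc k) false = cong suc (+-identityʳ k)
shape-size (suc k) true = +-comm k 1

shape-rowOrHook : ∀ a b → HookFits a b → RowOrHook (shape a b)
shape-rowOrHook zero b _ = inj₁ refl
shape-rowOrHook (suc k) false _ = inj₂ (inj₁ (k , refl))
shape-rowOrHook (suc zero) true fits with fits refl
... | s≤s ()
shape-rowOrHook (suc (suc k)) true _ = inj₂ (inj₂ (k , refl))

shape-hook : ∀ a b {k} → shape a b ≡ k ∷ 1 ∷ [] → b ≡ true
shape-hook (suc a) true _ = refl

shape-injectiveʳ : ∀ a b b′ → HookFits a b → HookFits a b′ → shape a b ≡ shape a b′ → b ≡ b′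
shape-injectiveʳ zero false false _ _ _ = refl
shape-injectiveʳ zero true _ fits _ _ with fits refl
... | ()
shape-injectiveʳ zero false true _ fits′ _ with fits′ refl
... | ()
shape-injectiveʳ (suc a) false false _ _ _ = refl
shape-injectiveʳ (suc a) true true _ _ _ = refl

shape-injective : ∀ {a a′ b b′} → HookFits a b → HookFits a′ b′ → shape a b ≡ shape a′ b′ → a ≡ a′ × b ≡ b′
shape-injective {a} {a′} {b} {b′} fits fits′ eq =
  same-size , shape-injectiveʳ a b b′ fits (subst (λ x → HookFits x b′) (sym same-size) fits′)
                (trans eq (cong (λ x → shape x b′) (sym same-size)))
  where
  same-size : a ≡ a′
  same-size = trans (sym (shape-size a b)) (trans (cong size eq) (shape-size a′ b′))

∅⊂□ : AddsSquare [] (1 ∷ [])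
∅⊂□ = (λ _ → z≤n) , refl

row⊂row : ∀ k → AddsSquare (suc k ∷ []) (suc (suc k) ∷ [])
row⊂row k = (λ { zero → n≤1+n (suc k) ; (suc _) → z≤n }) , refl

row⊂hook : ∀ k → AddsSquare (suc k ∷ []) (suc k ∷ 1 ∷ [])
row⊂hook k = (λ { zero → ≤-refl ; (suc _) → z≤n }) , cong suc (trans (+-comm k 1) (cong suc (sym (+-identityʳ k))))

hook⊂hook : ∀ k → AddsSquare (k ∷ 1 ∷ []) (suc k ∷ 1 ∷ [])
hook⊂hook k = (λ { zero → n≤1+n k ; (suc zero) → ≤-refl ; (suc (suc _)) → z≤n }) , refl

shape-grow : ∀ a b → HookFits (suc a) b → AddsSquare (shape a false) (shape (suc a) b)
shape-grow zero false _ = ∅⊂□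
shape-grow zero true fits with fits refl
... | s≤s ()
shape-grow (suc k) false _ = row⊂row k
shape-grow (suc k) true _ = row⊂hook k

shape-shrink : ∀ a b b′ → HookFits (suc a) b → HookFits a b′ → (b′ ≡ true → b ≡ true) →
  AddsSquare (shape a b′) (shape (suc a) b)
shape-shrink a false true _ _ hook⇒hook with hook⇒hook refl
... | ()
shape-shrink zero false false _ _ _ = ∅⊂□
shape-shrink zero true b′ fits _ _ with fits refl
... | s≤s ()
shape-shrink (suc k) false false _ _ _ = row⊂row k
shape-shrink (suc k) true false _ _ _ = row⊂hook k
shape-shrink (suc zero) true true _ fits′ _ with fits′ refl
... | s≤s ()
shape-shrink (suc (suc k)) true true _ _ _ = hook⊂hook (suc k)

shape-step : ∀ a a′ b b′ → HookFits a b → HookFits a′ b′ →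
  (a′ ≡ suc a × b ≡ false) ⊎ (a ≡ suc a′ × (b′ ≡ true → b ≡ true)) → OscStep (shape a b) (shape a′ b′)
shape-step a .(suc a) .false b′ _ fits′ (inj₁ (refl , refl)) = inj₁ (shape-grow a b′ fits′)
shape-step .(suc a′) a′ b b′ fits fits′ (inj₂ (refl , hook⇒hook)) = inj₂ (shape-shrink a′ b b′ fits fits′ hook⇒hook)

isHook : List ℕ → Bool
isHook (_ ∷ _ ∷ _) = true
isHook _ = false

shape-of : ∀ l → RowOrHook l → shape (size l) (isHook l) ≡ l
shape-of [] _ = refl
shape-of .(suc k ∷ []) (inj₂ (inj₁ (k , refl))) rewrite +-identityʳ k = refl
shape-of .(suc k ∷ 1 ∷ []) (inj₂ (inj₂ (k , refl))) rewrite +-comm k 1 = refl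

hook⊆⇒hook : ∀ {k l} → RowOrHook l → (k ∷ 1 ∷ []) ⊆Y l → isHook l ≡ true
hook⊆⇒hook (inj₁ refl) ⊆ = contradiction (⊆ 1) λ ()
hook⊆⇒hook (inj₂ (inj₁ (_ , refl))) ⊆ = contradiction (⊆ 1) λ ()
hook⊆⇒hook (inj₂ (inj₂ (_ , refl))) _ = refl

rowOrHook⇒isPartition : ∀ {l} → RowOrHook l → IsPartition l
rowOrHook⇒isPartition (inj₁ refl) = [] , []
rowOrHook⇒isPartition (inj₂ (inj₁ (k , refl))) = [ suc k ] , (s≤s z≤n ∷ [])
rowOrHook⇒isPartition (inj₂ (inj₂ (k , refl))) = (s≤s z≤n ∷ [ 1 ]) , (s≤s z≤n ∷ (s≤s z≤n ∷ []))

record IsRestrictedTableau (m : ℕ) (T : ℕ → List ℕ) : Set where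
  field
    starts-empty : T 0 ≡ []
    ends-empty   : T m ≡ []
    rowOrHook    : ∀ i → i ≤ m → RowOrHook (T i)
    oscStep      : ∀ i → i < m → OscStep (T i) (T (suc i))
    noHookGrowth : ∀ i → i < m → ∀ k → 1 ≤ k → T i ≡ k ∷ 1 ∷ [] → ¬ (T (suc i) ≡ suc k ∷ 1 ∷ [])

module RestrictedTableau {m : ℕ} {T : ℕ → List ℕ} (R : IsRestrictedTableau m T) where
  open IsRestrictedTableau R

  size-step : ∀ i → i < m → size (T (suc i)) ≡ suc (size (T i)) ⊎ size (T i) ≡ suc (size (T (suc i)))
  size-step i i<m with oscStep i i<m
  ... | inj₁ (_ , grows) = inj₁ grows
  ... | inj₂ (_ , shrinks) = inj₂ shrinks

  grow-size : ∀ i → i < m → size (T i) < size (T (suc i)) → size (T (suc i)) ≡ suc (size (T i))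
  grow-size i i<m lt with size-step i i<m
  ... | inj₁ eq = eq
  ... | inj₂ eq = contradiction (subst (size (T (suc i)) <_) (sym eq) (n<1+n _)) (<-asym lt)

  shrink-size : ∀ i → i < m → ¬ (size (T i) < size (T (suc i))) → size (T i) ≡ suc (size (T (suc i)))
  shrink-size i i<m ¬lt with size-step i i<m
  ... | inj₂ eq = eq
  ... | inj₁ eq = contradiction (subst (size (T i) <_) (sym eq) (n<1+n _)) ¬lt

  hook-shape : ∀ i → i ≤ m → isHook (T i) ≡ true → ∃ λ k → T i ≡ suc k ∷ 1 ∷ []
  hook-shape i i≤m hook with rowOrHook i i≤m
  ... | inj₂ (inj₂ (k , eq)) = k , eq
  ... | inj₁ eq = contradiction (subst (λ l → isHook l ≡ true) eq hook) λ ()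
  ... | inj₂ (inj₁ (_ , eq)) = contradiction (subst (λ l → isHook l ≡ true) eq hook) λ ()

  hook⇒2≤size : ∀ i → i ≤ m → isHook (T i) ≡ true → 2 ≤ size (T i)
  hook⇒2≤size i i≤m hook with hook-shape i i≤m hook
  ... | k , eq rewrite eq = s≤s (subst (1 ≤_) (+-comm 1 k) (s≤s z≤n))

  hook⇒shrinks : ∀ i → i < m → isHook (T i) ≡ true → ¬ (size (T i) < size (T (suc i)))
  hook⇒shrinks i i<m hook lt with oscStep i i<m | hook-shape i (<⇒≤ i<m) hook
  ... | inj₂ (_ , eq) | _ = <-asym lt (subst (size (T (suc i)) <_) (sym eq) (n<1+n _))
  ... | inj₁ (⊆ , eq) | k , Ti≡hook
      with hook-shape (suc i) i<m (hook⊆⇒hook (rowOrHook (suc i) i<m) (subst (_⊆Y T (suc i)) Ti≡hook ⊆))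
  ...   | j , T[1+i]≡hook = noHookGrowth i i<m (suc k) (s≤s z≤n) Ti≡hook
            (trans T[1+i]≡hook (cong (λ z → suc z ∷ 1 ∷ []) (suc-injective (+-cancelʳ-≡ 1 _ _ sizes))))
    where
    sizes : suc j + 1 ≡ suc (suc k) + 1
    sizes = trans (sym (cong size T[1+i]≡hook)) (trans eq (cong (λ l → suc (size l)) Ti≡hook))

  shrink-to-hook : ∀ i → i < m → isHook (T (suc i)) ≡ true → AddsSquare (T (suc i)) (T i) → isHook (T i) ≡ true
  shrink-to-hook i i<m hook (⊆ , _) with hook-shape (suc i) i<m hook
  ... | _ , eq = hook⊆⇒hook (rowOrHook i (<⇒≤ i<m)) (subst (_⊆Y T i) eq ⊆)

does⇒ : {A : Set} (a? : Dec A) → does a? ≡ true → A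
does⇒ a? holds = invert (subst (Reflects _) holds (proof a?))

module Tableau (m : ℕ) (P : ℕ → ℕ) where

  OpenAt : ℕ → ℕ → Set
  OpenAt i j = j < i × j < P j × i ≤ P j

  openAt? : ∀ i → Decidable (OpenAt i)
  openAt? i j = (j <? i) ×-dec ((j <? P j) ×-dec (i ≤? P j))

  openCount : ℕ → ℕ
  openCount i = count (openAt? i) m

  Crossed : ℕ → Set
  Crossed i = i < m × P i < i × ∃ λ j → j < i × P i < j × i < P j

  crossed? : Decidable Crossed
  crossed? i = (i <? m) ×-dec ((P i <? i) ×-dec anyUpTo? (λ j → (P i <? j) ×-dec (i <? P j)) i)

  -- openCount i counts the arcs open between positions i - 1 and i, while the
  -- hook flag looks ahead to position i.
  shapeAt : ℕ → List ℕ
  shapeAt i = shape (openCount i) (does (crossed? i))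

  crossed⇒closer : ∀ i → Crossed i → ¬ (i < P i)
  crossed⇒closer i (_ , Pi<i , _) i<Pi = <-asym i<Pi Pi<i

  crossed⇒open-above : ∀ i → Crossed i → ∃ λ j → OpenAt i j × P i < j
  crossed⇒open-above i (_ , _ , j , j<i , Pi<j , i<Pj) = j , (j<i , <-trans j<i i<Pj , <⇒≤ i<Pj) , Pi<j

  module _ (M : IsMatchingOn m P) where
    open IsMatchingOn M

    closer-open : ∀ i → i < m → ¬ (i < P i) → OpenAt i (P i)
    closer-open i i<m ¬opens = Pi<i , subst (P i <_) (sym (involutive i i<m)) Pi<i , ≤-reflexive (sym (involutive i i<m))
      where Pi<i = closer⇒partner< i i<m ¬opens

    openCount-zero : openCount 0 ≡ 0
    openCount-zero = count-none (openAt? 0) m (λ _ _ open₀ → n≮0 (proj₁ open₀))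

    openCount-m : openCount m ≡ 0
    openCount-m = count-none (openAt? m) m (λ y y<m (_ , _ , m≤Py) → <⇒≱ (partner<m y y<m) m≤Py)

    openCount-opener : ∀ i → i < m → i < P i → openCount (suc i) ≡ suc (openCount i)
    openCount-opener i i<m i<Pi = count-insert (openAt? (suc i)) (openAt? i) m i i<m
      (n<1+n i , i<Pi , i<Pi) (λ r → n≮n i (proj₁ r))
      (λ y _ y≢i (y<1+i , y-opens , 1+i≤Py) → ≤∧≢⇒< (≤-pred y<1+i) y≢i , y-opens , ≤-trans (n≤1+n i) 1+i≤Py)
      (λ y y<m y≢i (y<i , y-opens , i≤Py) → m<n⇒m<1+n y<i , y-opens ,
         ≤∧≢⇒< i≤Py (λ i≡Py → <-asym i<Pi (subst (_< i) (sym (trans (cong P i≡Py) (involutive y y<m))) y<i)))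

    openCount-closer : ∀ i → i < m → ¬ (i < P i) → openCount i ≡ suc (openCount (suc i))
    openCount-closer i i<m ¬opens = count-insert (openAt? i) (openAt? (suc i)) m (P i) (partner<m i i<m)
      (closer-open i i<m ¬opens)
      (λ (_ , _ , 1+i≤PPi) → n≮n i (subst (i <_) (involutive i i<m) 1+i≤PPi))
      (λ y y<m y≢Pi (y<i , y-opens , i≤Py) → m<n⇒m<1+n y<i , y-opens ,
         ≤∧≢⇒< i≤Py (λ i≡Py → y≢Pi (trans (sym (involutive y y<m)) (cong P (sym i≡Py)))))
      (λ y _ _ (y<1+i , y-opens , 1+i≤Py) →
         ≤∧≢⇒< (≤-pred y<1+i) (λ y≡i → ¬opens (subst (λ z → z < P z) y≡i y-opens)) , y-opens , ≤-trans (n≤1+n i) 1+i≤Py)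

    count-rises⇒opens : ∀ i → i < m → openCount (suc i) ≡ suc (openCount i) → i < P i
    count-rises⇒opens i i<m rises = decidable-stable (i <? P i) λ ¬opens →
      <⇒≢ (<-trans (n<1+n _) (n<1+n _)) (trans rises (cong suc (openCount-closer i i<m ¬opens)))

    crossed⇒2≤openCount : ∀ i → Crossed i → 2 ≤ openCount i
    crossed⇒2≤openCount i crossed@(i<m , Pi<i , j , j<i , Pi<j , i<Pj) =
      2≤count (openAt? i) m (P i) j (partner<m i i<m) (<-trans j<i i<m) (<⇒≢ Pi<j)
        (closer-open i i<m (crossed⇒closer i crossed)) (j<i , <-trans j<i i<Pj , <⇒≤ i<Pj)

    -- The arc (j , P j) crossing the arc closed at i + 1 also crosses the arc
    -- closed at i, unless j < P i: then the arcs closed at i + 1 and opened at j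
    -- together with the opener P i form 12312.
    closer-before-crossed : ∀ i → suc i < m → ¬ (i < P i) → ¬ Crossed i → Crossed (suc i) → Occurrence12312 m P
    closer-before-crossed i 1+i<m ¬opens ¬crossed (_ , P[1+i]<1+i , j , j<1+i , P[1+i]<j , 1+i<Pj) with <-cmp (P i) j
    ... | tri< Pi<j _ _ = ⊥-elim (¬crossed (i<m , Pi<i , j , j<i , Pi<j , <-trans (n<1+n i) 1+i<Pj))
      where
      i<m = <-trans (n<1+n i) 1+i<m
      Pi<i = closer⇒partner< i i<m ¬opens
      j<i : j < i
      j<i = ≤∧≢⇒< (≤-pred j<1+i) (λ j≡i → ¬opens (subst (λ z → z < P z) j≡i (<-trans j<1+i 1+i<Pj)))
    ... | tri≈ _ Pi≡j _ = ⊥-elim (<-asym (subst (suc i <_) Pj≡i 1+i<Pj) (n<1+n i))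
      where
      Pj≡i : P j ≡ i
      Pj≡i = partner-sym (<-trans (n<1+n i) 1+i<m) Pi≡j
    ... | tri> _ _ j<Pi = occurrence (P (suc i)) j (P i) (suc i) (P j) P[1+i]<j j<Pi
           (<-trans Pi<i (n<1+n i)) 1+i<Pj (partner<m j (<-trans j<1+i 1+i<m))
           (involutive (suc i) 1+i<m) refl (subst (P i <_) (sym (involutive i i<m)) Pi<i)
      where
      i<m = <-trans (n<1+n i) 1+i<m
      Pi<i = closer⇒partner< i i<m ¬opens

module Forward (m : ℕ) (P : ℕ → ℕ) (M : IsMatchingOn m P) (avoids : ¬ Occurrence12312 m P) where
  open Tableau m P

  hookFits : ∀ i → HookFits (openCount i) (does (crossed? i))
  hookFits i hook = crossed⇒2≤openCount M i (does⇒ (crossed? i) hook)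

  shapeAt-rowOrHook : ∀ i → RowOrHook (shapeAt i)
  shapeAt-rowOrHook i = shape-rowOrHook _ _ (hookFits i)

  shapeAt-zero : shapeAt 0 ≡ []
  shapeAt-zero rewrite openCount-zero M = refl

  shapeAt-m : shapeAt m ≡ []
  shapeAt-m rewrite openCount-m M = refl

  shapeAt-step : ∀ i → i < m → OscStep (shapeAt i) (shapeAt (suc i))
  shapeAt-step i i<m with i <? P i
  ... | yes opens = shape-step _ _ _ _ (hookFits i) (hookFits (suc i))
          (inj₁ (openCount-opener M i i<m opens , dec-false (crossed? i) (λ c → crossed⇒closer i c opens)))
  ... | no ¬opens = shape-step _ _ _ _ (hookFits i) (hookFits (suc i))
          (inj₂ (openCount-closer M i i<m ¬opens , hook-persists))
    where
    hook-persists : does (crossed? (suc i)) ≡ true → does (crossed? i) ≡ true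
    hook-persists hook = dec-true (crossed? i) (decidable-stable (crossed? i) λ ¬crossed →
      avoids (closer-before-crossed M i (proj₁ crossed′) ¬opens ¬crossed crossed′))
      where crossed′ = does⇒ (crossed? (suc i)) hook

  openCount-of-shape : ∀ i {l} → shapeAt i ≡ l → openCount i ≡ size l
  openCount-of-shape i eq = trans (sym (shape-size _ _)) (cong size eq)

  shapeAt-noHookGrowth : ∀ i → i < m → ∀ k → shapeAt i ≡ k ∷ 1 ∷ [] → ¬ (shapeAt (suc i) ≡ suc k ∷ 1 ∷ [])
  shapeAt-noHookGrowth i i<m k hook hook′ = <⇒≢ (s≤s (s≤s (n≤1+n k))) (begin
    suc k                         ≡⟨ shape-size (suc k) true ⟨
    size (k ∷ 1 ∷ [])             ≡⟨ openCount-of-shape i hook ⟨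
    openCount i                   ≡⟨ openCount-closer M i i<m (crossed⇒closer i crossed) ⟩
    suc (openCount (suc i))       ≡⟨ cong suc (openCount-of-shape (suc i) hook′) ⟩
    suc (size (suc k ∷ 1 ∷ []))   ≡⟨ cong suc (shape-size (suc (suc k)) true) ⟩
    suc (suc (suc k))             ∎)
    where
    open ≡-Reasoning
    crossed : Crossed i
    crossed = does⇒ (crossed? i) (shape-hook _ _ hook)

  shapeAt-restricted : IsRestrictedTableau m shapeAt
  shapeAt-restricted = record
    { starts-empty = shapeAt-zero
    ; ends-empty = shapeAt-m
    ; rowOrHook = λ i _ → shapeAt-rowOrHook i
    ; oscStep = shapeAt-step
    ; noHookGrowth = λ i i<m k _ → shapeAt-noHookGrowth i i<m k }

lookupℕ : {A : Set} {k : ℕ} → A → Vec A k → ℕ → A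
lookupℕ d [] _ = d
lookupℕ d (x ∷ _) zero = x
lookupℕ d (_ ∷ xs) (suc i) = lookupℕ d xs i

lookupℕ-toℕ : {A : Set} {k : ℕ} (d : A) (xs : Vec A k) (i : Fin k) → lookupℕ d xs (toℕ i) ≡ lookup xs i
lookupℕ-toℕ d (x ∷ xs) fzero = refl
lookupℕ-toℕ d (x ∷ xs) (fsuc i) = lookupℕ-toℕ d xs i

countB-mono : {A : Set} (f g : A → Bool) (xs : List A) → (∀ x → T (f x) → T (g x)) →
  countB f xs ≤ countB g xs
countB-mono f g [] f⇒g = z≤n
countB-mono f g (x ∷ xs) f⇒g with f x in fx | g x in gx
... | true | true = s≤s (countB-mono f g xs f⇒g)
... | true | false = contradiction (subst T gx (f⇒g x (subst T (sym fx) tt))) id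
... | false | true = m≤n⇒m≤1+n (countB-mono f g xs f⇒g)
... | false | false = countB-mono f g xs f⇒g

countB-< : {A : Set} (f g : A → Bool) (xs : List A) → (∀ x → T (f x) → T (g x)) →
  ∀ y → y ∈ xs → T (g y) → ¬ T (f y) → countB f xs < countB g xs
countB-< f g (x ∷ xs) f⇒g y (here refl) gy ¬fy with f x | g x
... | true | _ = contradiction tt ¬fy
... | false | false = contradiction gy id
... | false | true = s≤s (countB-mono f g xs f⇒g)
countB-< f g (x ∷ xs) f⇒g y (there y∈xs) gy ¬fy with f x in fx | g x in gx
... | true | true = s≤s (countB-< f g xs f⇒g y y∈xs gy ¬fy)
... | true | false = contradiction (subst T gx (f⇒g x (subst T (sym fx) tt))) id
... | false | true = m<n⇒m<1+n (countB-< f g xs f⇒g y y∈xs gy ¬fy)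
... | false | false = countB-< f g xs f⇒g y y∈xs gy ¬fy

module CanonicalForm {m : ℕ} (p : Vec (Fin m) m) where

  P : ℕ → ℕ
  P = lookupℕ 0 (Vec.map toℕ p)

  P-toℕ : ∀ j → P (toℕ j) ≡ toℕ (lookup p j)
  P-toℕ j = trans (lookupℕ-toℕ 0 (Vec.map toℕ p) j) (VecP.lookup-map j toℕ p)

  P-fromℕ< : ∀ {x} (x<m : x < m) → P x ≡ toℕ (lookup p (fromℕ< x<m))
  P-fromℕ< x<m = trans (cong P (sym (toℕ-fromℕ< x<m))) (P-toℕ (fromℕ< x<m))

  opensBy : ℕ → Fin m → Bool
  opensBy x j = (toℕ j ≤ᵇ x) ∧ (toℕ j <ᵇ toℕ (partnerOf p j))

  -- canonicalForm p i is definitionally openersUpTo (toℕ (opener p i))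
  openersUpTo : ℕ → ℕ
  openersUpTo x = countB (opensBy x) (allFin m)

  opensBy-intro : ∀ {x} j → toℕ j ≤ x → toℕ j < toℕ (lookup p j) → T (opensBy x j)
  opensBy-intro j j≤x j-opens = Equivalence.from T-∧ (≤⇒≤ᵇ j≤x , <⇒<ᵇ j-opens)

  opensBy-elim : ∀ {x} j → T (opensBy x j) → toℕ j ≤ x × toℕ j < toℕ (lookup p j)
  opensBy-elim {x} j holds with Equivalence.to (T-∧ {toℕ j ≤ᵇ x}) holds
  ... | j≤x , j-opens = ≤ᵇ⇒≤ (toℕ j) x j≤x , <ᵇ⇒< (toℕ j) (toℕ (lookup p j)) j-opens

  opensBy-mono : ∀ {x y} → x ≤ y → ∀ j → T (opensBy x j) → T (opensBy y j)
  opensBy-mono x≤y j holds with opensBy-elim j holds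
  ... | j≤x , j-opens = opensBy-intro j (≤-trans j≤x x≤y) j-opens

  openersUpTo-mono : ∀ {x y} → x ≤ y → openersUpTo x ≤ openersUpTo y
  openersUpTo-mono x≤y = countB-mono _ _ (allFin m) (opensBy-mono x≤y)

  openersUpTo-< : ∀ {x} (j : Fin m) → x < toℕ j → toℕ j < toℕ (lookup p j) → openersUpTo x < openersUpTo (toℕ j)
  openersUpTo-< {x} j x<j j-opens = countB-< _ _ (allFin m) (opensBy-mono (<⇒≤ x<j)) j (∈-allFin j)
    (opensBy-intro j ≤-refl j-opens) (λ holds → <⇒≱ x<j (proj₁ (opensBy-elim j holds)))

  openersUpTo-<′ : ∀ {x y} (y<m : y < m) → x < y → y < P y → openersUpTo x < openersUpTo y
  openersUpTo-<′ y<m x<y y-opens = subst (λ z → openersUpTo _ < openersUpTo z) (toℕ-fromℕ< y<m)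
    (openersUpTo-< (fromℕ< y<m) (subst (_ <_) (sym (toℕ-fromℕ< y<m)) x<y)
      (subst₂ _<_ (sym (toℕ-fromℕ< y<m)) (P-fromℕ< y<m) y-opens))

  opener-self : ∀ i → toℕ i < toℕ (lookup p i) → opener p i ≡ i
  opener-self i i<pi rewrite Equivalence.to T-≡ (≤⇒≤ᵇ (<⇒≤ i<pi)) = refl

  opener-partner : ∀ i → toℕ (lookup p i) < toℕ i → opener p i ≡ lookup p i
  opener-partner i pi<i with toℕ i ≤ᵇ toℕ (lookup p i) in le
  ... | true = contradiction (≤ᵇ⇒≤ _ _ (subst T (sym le) tt)) (<⇒≱ pi<i)
  ... | false = refl

  module _ (M : IsMatching p) where

    matchingOn : IsMatchingOn m P
    matchingOn = record
      { partner<m = λ x x<m → subst (_< m) (sym (P-fromℕ< x<m)) (toℕ<n _)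
      ; involutive = λ x x<m → begin
          P (P x)                                    ≡⟨ cong P (P-fromℕ< x<m) ⟩
          P (toℕ (lookup p (fromℕ< x<m)))             ≡⟨ P-toℕ _ ⟩
          toℕ (lookup p (lookup p (fromℕ< x<m)))      ≡⟨ cong toℕ (proj₁ M (fromℕ< x<m)) ⟩
          toℕ (fromℕ< x<m)                            ≡⟨ toℕ-fromℕ< x<m ⟩
          x                                          ∎
      ; fixpoint-free = λ x x<m Px≡x → proj₂ M (fromℕ< x<m)
          (toℕ-injective (trans (sym (P-fromℕ< x<m)) (trans Px≡x (sym (toℕ-fromℕ< x<m))))) }
      where open ≡-Reasoning

    open IsMatchingOn matchingOn

    opener-cases : ∀ i → (toℕ i < toℕ (lookup p i) × opener p i ≡ i) ⊎ (toℕ (lookup p i) < toℕ i × opener p i ≡ lookup p i)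
    opener-cases i with <-cmp (toℕ i) (toℕ (lookup p i))
    ... | tri< i<pi _ _ = inj₁ (i<pi , opener-self i i<pi)
    ... | tri≈ _ i≡pi _ = ⊥-elim (proj₂ M i (toℕ-injective (sym i≡pi)))
    ... | tri> _ _ pi<i = inj₂ (pi<i , opener-partner i pi<i)

    opener-opens : ∀ i → toℕ (opener p i) < toℕ (lookup p (opener p i))
    opener-opens i with opener-cases i
    ... | inj₁ (i<pi , eq) rewrite eq = i<pi
    ... | inj₂ (pi<i , eq) rewrite eq | proj₁ M i = pi<i

    opener≤ : ∀ i → toℕ (opener p i) ≤ toℕ i
    opener≤ i with opener-cases i
    ... | inj₁ (_ , eq) rewrite eq = ≤-refl
    ... | inj₂ (pi<i , eq) rewrite eq = <⇒≤ pi<i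

    canonicalForm-< : ∀ a b → canonicalForm p a < canonicalForm p b → toℕ (opener p a) < toℕ (opener p b)
    canonicalForm-< a b lt with <-cmp (toℕ (opener p a)) (toℕ (opener p b))
    ... | tri< oa<ob _ _ = oa<ob
    ... | tri≈ _ oa≡ob _ = contradiction (cong openersUpTo oa≡ob) (<⇒≢ lt)
    ... | tri> _ _ ob<oa = contradiction (openersUpTo-mono (<⇒≤ ob<oa)) (<⇒≱ lt)

    canonicalForm-≡ : ∀ a b → canonicalForm p a ≡ canonicalForm p b → toℕ (opener p a) ≡ toℕ (opener p b)
    canonicalForm-≡ a b eq with <-cmp (toℕ (opener p a)) (toℕ (opener p b))
    ... | tri≈ _ oa≡ob _ = oa≡ob
    ... | tri< oa<ob _ _ = contradiction eq (<⇒≢ (openersUpTo-< (opener p b) oa<ob (opener-opens b)))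
    ... | tri> _ _ ob<oa = contradiction (sym eq) (<⇒≢ (openersUpTo-< (opener p a) ob<oa (opener-opens a)))

    sameOpener⇒partners : ∀ a b → toℕ a < toℕ b → toℕ (opener p a) ≡ toℕ (opener p b) → P (toℕ a) ≡ toℕ b
    sameOpener⇒partners a b a<b eq with opener-cases a | opener-cases b
    ... | inj₁ (_ , oa) | inj₁ (_ , ob) rewrite oa | ob = contradiction eq (<⇒≢ a<b)
    ... | inj₁ (_ , oa) | inj₂ (_ , ob) rewrite oa | ob =
          trans (cong P eq) (trans (cong P (sym (P-toℕ b))) (involutive (toℕ b) (toℕ<n b)))
    ... | inj₂ (_ , oa) | inj₁ (_ , ob) rewrite oa | ob = trans (P-toℕ a) eq
    ... | inj₂ (pa<a , oa) | inj₂ (pb<b , ob) rewrite oa | ob = contradiction a≡b (<⇒≢ a<b)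
      where
      a≡b : toℕ a ≡ toℕ b
      a≡b = trans (sym (involutive (toℕ a) (toℕ<n a)))
              (trans (cong P (trans (P-toℕ a) (trans eq (sym (P-toℕ b))))) (involutive (toℕ b) (toℕ<n b)))

    opener-at-self : ∀ {x} (x<m : x < m) → x < P x → toℕ (opener p (fromℕ< x<m)) ≡ x
    opener-at-self x<m x<Px = trans (cong toℕ (opener-self _ (subst₂ _<_ (sym (toℕ-fromℕ< x<m)) (P-fromℕ< x<m) x<Px)))
                                    (toℕ-fromℕ< x<m)

    opener-at-partner : ∀ {x} (x<m : x < m) → P x < x → toℕ (opener p (fromℕ< x<m)) ≡ P x
    opener-at-partner x<m Px<x = trans (cong toℕ (opener-partner _ (subst₂ _<_ (P-fromℕ< x<m) (sym (toℕ-fromℕ< x<m)) Px<x)))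
                                       (sym (P-fromℕ< x<m))

<-from-steps : (f : ℕ → ℕ) {lo hi : ℕ} → (∀ t → lo ≤ t → suc t ≤ hi → f t < f (suc t)) →
  ∀ {i j} → lo ≤ i → i < j → j ≤ hi → f i < f j
<-from-steps f step {i = i} {suc j} lo≤i i<1+j 1+j≤hi with m<1+n⇒m<n∨m≡n i<1+j
... | inj₁ i<j = <-trans (<-from-steps f step lo≤i i<j (≤-trans (n≤1+n j) 1+j≤hi)) (step j (≤-trans lo≤i (<⇒≤ i<j)) 1+j≤hi)
... | inj₂ refl = step i lo≤i 1+j≤hi

orderIsomorphic : {k : ℕ} (τ w : Fin k → ℕ) (g : ℕ → ℕ) → (∀ a → w a ≡ g (τ a)) →
  (∀ a b → τ a < τ b → g (τ a) < g (τ b)) → ∀ a b → (w a < w b → τ a < τ b) × (τ a < τ b → w a < w b)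
orderIsomorphic τ w g w≡gτ g-mono a b rewrite w≡gτ a | w≡gτ b = reflect , g-mono a b
  where
  reflect : g (τ a) < g (τ b) → τ a < τ b
  reflect lt with <-cmp (τ a) (τ b)
  ... | tri< τa<τb _ _ = τa<τb
  ... | tri≈ _ τa≡τb _ = contradiction (cong g τa≡τb) (<⇒≢ lt)
  ... | tri> _ _ τb<τa = contradiction (g-mono b a τb<τa) (<-asym lt)

pattern f0 = fzero
pattern f1 = fsuc fzero
pattern f2 = fsuc (fsuc fzero)
pattern f3 = fsuc (fsuc (fsuc fzero))
pattern f4 = fsuc (fsuc (fsuc (fsuc fzero)))

pat12312-range : ∀ a → 1 ≤ pat12312 a × pat12312 a ≤ 3
pat12312-range f0 = ≤-refl , s≤s z≤n
pat12312-range f1 = s≤s z≤n , s≤s (s≤s z≤n)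
pat12312-range f2 = s≤s z≤n , ≤-refl
pat12312-range f3 = ≤-refl , s≤s z≤n
pat12312-range f4 = s≤s z≤n , s≤s (s≤s z≤n)

sameLetter : {m k : ℕ} {w : Fin m → ℕ} {τ : Fin k → ℕ} → ((s , _ , iso) : Contains w τ) →
  ∀ a b → τ a ≡ τ b → w (s a) ≡ w (s b)
sameLetter (s , _ , iso) a b τa≡τb =
  ≤-antisym (≮⇒≥ (λ lt → <-irrefl (sym τa≡τb) (proj₁ (iso b a) lt))) (≮⇒≥ (λ lt → <-irrefl τa≡τb (proj₁ (iso a b) lt)))

module Pattern12312 {m : ℕ} (p : Vec (Fin m) m) (M : IsMatching p) where
  open CanonicalForm p
  open IsMatchingOn (matchingOn M)

  contains⇒occurrence : Contains (canonicalForm p) pat12312 → Occurrence12312 m P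
  contains⇒occurrence c@(s , increasing , iso) =
    occurrence (y f0) (y f1) x₃ (y f3) (y f4) (increasing f0 f1 z<s) y₁<x₃ x₃<y₃ (increasing f3 f4 (s<s (s<s (s<s z<s))))
      (toℕ<n (s f4)) (partners f0 f3 z<s refl) (partners f1 f4 (s<s z<s) refl) x₃-opens
    where
    y : Fin 5 → ℕ
    y a = toℕ (s a)
    x₃ = toℕ (opener p (s f2))
    partners : ∀ a b → toℕ a < toℕ b → pat12312 a ≡ pat12312 b → P (y a) ≡ y b
    partners a b a<b same = sameOpener⇒partners M (s a) (s b) (increasing a b a<b)
                              (canonicalForm-≡ M (s a) (s b) (sameLetter {w = canonicalForm p} c a b same))
    y₁-opens : toℕ (opener p (s f1)) ≡ y f1
    y₁-opens = cong toℕ (opener-self (s f1) (subst (y f1 <_)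
                 (trans (sym (partners f1 f4 (s<s z<s) refl)) (P-toℕ (s f1))) (increasing f1 f4 (s<s z<s))))
    y₁<x₃ : y f1 < x₃
    y₁<x₃ = subst (_< x₃) y₁-opens (canonicalForm-< M (s f1) (s f2) (proj₂ (iso f1 f2) (s<s (s<s z<s))))
    x₃<y₃ : x₃ < y f3
    x₃<y₃ = ≤-<-trans (opener≤ M (s f2)) (increasing f2 f3 (s<s (s<s z<s)))
    x₃-opens : x₃ < P x₃
    x₃-opens = subst (x₃ <_) (sym (P-toℕ (opener p (s f2)))) (opener-opens M (s f2))

  module Embedding (o : Occurrence12312 m P) where
    open Occurrence12312 o

    x₄<m = <-trans x₄<x₅ x₅<m
    x₃<m = <-trans x₃<x₄ x₄<m
    x₂<m = <-trans x₂<x₃ x₃<m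
    x₁<m = <-trans x₁<x₂ x₂<m

    position : ℕ → ℕ
    position 0 = x₁
    position 1 = x₂
    position 2 = x₃
    position 3 = x₄
    position _ = x₅

    position<m : ∀ t → position t < m
    position<m 0 = x₁<m
    position<m 1 = x₂<m
    position<m 2 = x₃<m
    position<m 3 = x₄<m
    position<m (suc (suc (suc (suc _)))) = x₅<m

    position-step : ∀ t → 0 ≤ t → suc t ≤ 4 → position t < position (suc t)
    position-step 0 _ _ = x₁<x₂
    position-step 1 _ _ = x₂<x₃
    position-step 2 _ _ = x₃<x₄
    position-step 3 _ _ = x₄<x₅
    position-step (suc (suc (suc (suc _)))) _ (s≤s (s≤s (s≤s (s≤s ()))))

    select : Fin 5 → Fin m
    select a = fromℕ< (position<m (toℕ a))

    select-increasing : ∀ a b → toℕ a < toℕ b → toℕ (select a) < toℕ (select b)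
    select-increasing a b a<b = subst₂ _<_ (sym (toℕ-fromℕ< _)) (sym (toℕ-fromℕ< _))
      (<-from-steps position position-step z≤n a<b (≤-pred (toℕ<n b)))

    letterOpener : ℕ → ℕ
    letterOpener 1 = x₁
    letterOpener 2 = x₂
    letterOpener _ = x₃

    x₁<x₄ = <-trans x₁<x₂ (<-trans x₂<x₃ x₃<x₄)
    x₂<x₅ = <-trans x₂<x₃ (<-trans x₃<x₄ x₄<x₅)

    x₁-opens : x₁ < P x₁
    x₁-opens = subst (x₁ <_) (sym arc₁₄) x₁<x₄
    x₂-opens : x₂ < P x₂
    x₂-opens = subst (x₂ <_) (sym arc₂₅) x₂<x₅

    letters : ∀ a → canonicalForm p (select a) ≡ openersUpTo (letterOpener (pat12312 a))
    letters f0 = cong openersUpTo (opener-at-self M x₁<m x₁-opens)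
    letters f1 = cong openersUpTo (opener-at-self M x₂<m x₂-opens)
    letters f2 = cong openersUpTo (opener-at-self M x₃<m x₃-opens)
    letters f3 = cong openersUpTo (trans (opener-at-partner M x₄<m (subst (_< x₄) (sym Px₄) x₁<x₄)) Px₄)
      where Px₄ = partner-sym x₁<m arc₁₄
    letters f4 = cong openersUpTo (trans (opener-at-partner M x₅<m (subst (_< x₅) (sym Px₅) x₂<x₅)) Px₅)
      where Px₅ = partner-sym x₂<m arc₂₅

    letter-step : ∀ t → 1 ≤ t → suc t ≤ 3 → openersUpTo (letterOpener t) < openersUpTo (letterOpener (suc t))
    letter-step 1 _ _ = openersUpTo-<′ x₂<m x₁<x₂ x₂-opens
    letter-step 2 _ _ = openersUpTo-<′ x₃<m x₂<x₃ x₃-opens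
    letter-step (suc (suc (suc _))) _ (s≤s (s≤s (s≤s ())))

    letters-mono : ∀ a b → pat12312 a < pat12312 b →
      openersUpTo (letterOpener (pat12312 a)) < openersUpTo (letterOpener (pat12312 b))
    letters-mono a b lt = <-from-steps (openersUpTo ∘ letterOpener) letter-step (proj₁ (pat12312-range a)) lt (proj₂ (pat12312-range b))

  occurrence⇒contains : Occurrence12312 m P → Contains (canonicalForm p) pat12312
  occurrence⇒contains o = select , select-increasing ,
    orderIsomorphic pat12312 (canonicalForm p ∘ select) (openersUpTo ∘ letterOpener) letters letters-mono
    where open Embedding o

MatchingAvoiding12312 : (m : ℕ) → Vec (Fin m) m → Set
MatchingAvoiding12312 m p = IsMatching p × Avoids (canonicalForm p) pat12312

module AvoidingMatching {m : ℕ} (p : Vec (Fin m) m) (valid : MatchingAvoiding12312 m p) where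
  open CanonicalForm p using (P)
  open Tableau m P

  isMatchingOn : IsMatchingOn m P
  isMatchingOn = CanonicalForm.matchingOn p (proj₁ valid)

  avoids : ¬ Occurrence12312 m P
  avoids occ = proj₂ valid (Pattern12312.occurrence⇒contains p (proj₁ valid) occ)

  open Forward m P isMatchingOn avoids public

module Recovery (m : ℕ) (P : ℕ → ℕ) (M : IsMatchingOn m P) (avoids : ¬ Occurrence12312 m P) where
  open Tableau m P
  open IsMatchingOn M

  open-above⇒still-open : ∀ i → i < m → ∀ j → OpenAt i j → P i < j → i < P j
  open-above⇒still-open i i<m j (j<i , _ , i≤Pj) Pi<j =
    ≤∧≢⇒< i≤Pj (λ i≡Pj → <-irrefl (trans (cong P i≡Pj) (involutive j (<-trans j<i i<m))) Pi<j)

  uncrossed⇒latest : ∀ i → i < m → ¬ (i < P i) → ¬ Crossed i → ∀ j → OpenAt i j → j ≤ P i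
  uncrossed⇒latest i i<m ¬opens ¬crossed j j-open@(j<i , _ , _) =
    ≮⇒≥ (λ Pi<j → ¬crossed (i<m , closer⇒partner< i i<m ¬opens , j , j<i , Pi<j , open-above⇒still-open i i<m j j-open Pi<j))

  two-open-above⇒occurrence : ∀ i → i < m → ∀ j k → OpenAt i j → OpenAt i k → P i < j → j < k → Occurrence12312 m P
  two-open-above⇒occurrence i i<m j k j-open@(j<i , _ , _) (k<i , k-opens , _) Pi<j j<k =
    occurrence (P i) j k i (P j) Pi<j j<k k<i (open-above⇒still-open i i<m j j-open Pi<j)
      (partner<m j (<-trans j<i i<m)) (involutive i i<m) refl k-opens

  open-above-unique : ∀ i → i < m → ∀ j k → OpenAt i j → OpenAt i k → P i < j → P i < k → j ≡ k
  open-above-unique i i<m j k j-open k-open Pi<j Pi<k with <-cmp j k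
  ... | tri≈ _ j≡k _ = j≡k
  ... | tri< j<k _ _ = ⊥-elim (avoids (two-open-above⇒occurrence i i<m j k j-open k-open Pi<j j<k))
  ... | tri> _ _ k<j = ⊥-elim (avoids (two-open-above⇒occurrence i i<m k j k-open j-open Pi<k k<j))

module Transfer (m : ℕ) (P Q : ℕ → ℕ) (MP : IsMatchingOn m P) (MQ : IsMatchingOn m Q) (avoidsQ : ¬ Occurrence12312 m Q)
  (sameCount : ∀ i → i ≤ m → Tableau.openCount m P i ≡ Tableau.openCount m Q i) where
  module TP = Tableau m P
  module TQ = Tableau m Q
  module P′ = IsMatchingOn MP
  module Q′ = IsMatchingOn MQ
  module RQ = Recovery m Q MQ avoidsQ

  opens-transfer : ∀ i → i < m → i < P i → i < Q i
  opens-transfer i i<m opens = TQ.count-rises⇒opens MQ i i<m (begin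
    TQ.openCount (suc i) ≡⟨ sameCount (suc i) i<m ⟨
    TP.openCount (suc i) ≡⟨ TP.openCount-opener MP i i<m opens ⟩
    suc (TP.openCount i) ≡⟨ cong suc (sameCount i (<⇒≤ i<m)) ⟩
    suc (TQ.openCount i) ∎)
    where open ≡-Reasoning

  open-transfer : ∀ i → i < m → (∀ c → c < i → ¬ (c < Q c) → P c ≡ Q c) → ∀ j → TP.OpenAt i j → TQ.OpenAt i j
  open-transfer i i<m agreeBelow j (j<i , j-opens , i≤Pj) = j<i , j-opensQ , ≮⇒≥ Qj≮i
    where
    j<m = <-trans j<i i<m
    j-opensQ = opens-transfer j j<m j-opens
    Qj≮i : ¬ (Q j < i)
    Qj≮i Qj<i = <⇒≱ (subst (_< i) (sym Pj≡Qj) Qj<i) i≤Pj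
      where
      Qj-closes : ¬ (Q j < Q (Q j))
      Qj-closes lt = <-asym j-opensQ (subst (Q j <_) (Q′.involutive j j<m) lt)
      P[Qj]≡j : P (Q j) ≡ j
      P[Qj]≡j = trans (agreeBelow (Q j) Qj<i Qj-closes) (Q′.involutive j j<m)
      Pj≡Qj : P j ≡ Q j
      Pj≡Qj = P′.partner-sym (Q′.partner<m j j<m) P[Qj]≡j

  -- Both P i and, if the arc closing at i is crossed, the crossing arc above P i
  -- are arcs of Q open at i; neither can lie above Q i.
  closer-partner≤ : ∀ i → i < m → ¬ (i < Q i) → (TQ.Crossed i → TP.Crossed i) →
    (∀ c → c < i → ¬ (c < Q c) → P c ≡ Q c) → P i ≤ Q i
  closer-partner≤ i i<m ¬opensQ crossedQ⇒P agreeBelow = ≮⇒≥ λ Qi<Pi → by-crossing Qi<Pi (TQ.crossed? i)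
    where
    transfer = open-transfer i i<m agreeBelow
    Pi-open = TP.closer-open MP i i<m (λ opens → ¬opensQ (opens-transfer i i<m opens))
    by-crossing : Q i < P i → Dec (TQ.Crossed i) → ⊥
    by-crossing Qi<Pi (no ¬crossed) = <⇒≱ Qi<Pi (RQ.uncrossed⇒latest i i<m ¬opensQ ¬crossed (P i) (transfer (P i) Pi-open))
    by-crossing Qi<Pi (yes crossed) with TP.crossed⇒open-above i (crossedQ⇒P crossed)
    ... | b , b-open , Pi<b = <⇒≢ Pi<b
          (RQ.open-above-unique i i<m (P i) b (transfer (P i) Pi-open) (transfer b b-open) Qi<Pi (<-trans Qi<Pi Pi<b))

module Uniqueness (m : ℕ) (P Q : ℕ → ℕ) (MP : IsMatchingOn m P) (MQ : IsMatchingOn m Q)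
  (avoidsP : ¬ Occurrence12312 m P) (avoidsQ : ¬ Occurrence12312 m Q)
  (sameCount : ∀ i → i ≤ m → Tableau.openCount m P i ≡ Tableau.openCount m Q i)
  (sameHook : ∀ i → i < m → does (Tableau.crossed? m P i) ≡ does (Tableau.crossed? m Q i)) where
  module TP = Tableau m P
  module TQ = Tableau m Q
  module P′ = IsMatchingOn MP
  module Q′ = IsMatchingOn MQ
  module P→Q = Transfer m P Q MP MQ avoidsQ sameCount
  module Q→P = Transfer m Q P MQ MP avoidsP (λ i i≤m → sym (sameCount i i≤m))

  crossedP⇒Q : ∀ i → i < m → TP.Crossed i → TQ.Crossed i
  crossedP⇒Q i i<m crossed = does⇒ (TQ.crossed? i) (trans (sym (sameHook i i<m)) (dec-true (TP.crossed? i) crossed))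

  crossedQ⇒P : ∀ i → i < m → TQ.Crossed i → TP.Crossed i
  crossedQ⇒P i i<m crossed = does⇒ (TP.crossed? i) (trans (sameHook i i<m) (dec-true (TQ.crossed? i) crossed))

  closers-agree : ∀ i → i < m → ¬ (i < P i) → P i ≡ Q i
  closers-agree = <-rec _ step
    where
    step : ∀ i → (∀ {c} → c < i → c < m → ¬ (c < P c) → P c ≡ Q c) → i < m → ¬ (i < P i) → P i ≡ Q i
    step i rec i<m ¬opensP = ≤-antisym (P→Q.closer-partner≤ i i<m ¬opensQ (crossedQ⇒P i i<m) agreeQ)
                                       (Q→P.closer-partner≤ i i<m ¬opensP (crossedP⇒Q i i<m) agreeP)
      where
      ¬opensQ : ¬ (i < Q i)
      ¬opensQ opens = ¬opensP (Q→P.opens-transfer i i<m opens)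
      agreeQ : ∀ c → c < i → ¬ (c < Q c) → P c ≡ Q c
      agreeQ c c<i ¬opens = rec c<i (<-trans c<i i<m) (λ opens → ¬opens (P→Q.opens-transfer c (<-trans c<i i<m) opens))
      agreeP : ∀ c → c < i → ¬ (c < P c) → Q c ≡ P c
      agreeP c c<i ¬opens = sym (rec c<i (<-trans c<i i<m) ¬opens)

  partners-agree : ∀ x → x < m → P x ≡ Q x
  partners-agree x x<m with x <? P x
  ... | no ¬opens = closers-agree x x<m ¬opens
  ... | yes opens = begin
    P x         ≡⟨ Q′.involutive (P x) Px<m ⟨
    Q (Q (P x)) ≡⟨ cong Q Q[Px]≡x ⟩
    Q x         ∎
    where
    open ≡-Reasoning
    Px<m = P′.partner<m x x<m
    Px-closes : ¬ (P x < P (P x))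
    Px-closes lt = <-asym opens (subst (P x <_) (P′.involutive x x<m) lt)
    Q[Px]≡x : Q (P x) ≡ x
    Q[Px]≡x = trans (sym (closers-agree (P x) Px<m Px-closes)) (P′.involutive x x<m)

data Move : Set where
  push popTop popSecond : Move

update : (ℕ → ℕ) → ℕ → ℕ → ℕ → ℕ
update f x v y with y ≟ x
... | yes _ = v
... | no _ = f y

update-same : ∀ f x v → update f x v x ≡ v
update-same f x v with x ≟ x
... | yes _ = refl
... | no x≢x = contradiction refl x≢x

update-other : ∀ f x v y → y ≢ x → update f x v y ≡ f y
update-other f x v y y≢x with y ≟ x
... | yes y≡x = contradiction y≡x y≢x
... | no _ = refl

link : (ℕ → ℕ) → ℕ → ℕ → ℕ → ℕ
link f i a = update (update f i a) a i

link-here : ∀ f i a → a ≢ i → link f i a i ≡ a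
link-here f i a a≢i = trans (update-other (update f i a) a i i (≢-sym a≢i)) (update-same f i a)

link-there : ∀ f i a → link f i a a ≡ i
link-there f i a = update-same (update f i a) a i

link-elsewhere : ∀ f i a y → y ≢ i → y ≢ a → link f i a y ≡ f y
link-elsewhere f i a y y≢i y≢a = trans (update-other (update f i a) a i y y≢a) (update-other f i a y y≢i)

∈⇒length≢0 : {A : Set} {x : A} {xs : List A} → x ∈ xs → length xs ≢ 0
∈⇒length≢0 (here _) ()
∈⇒length≢0 (there _) ()

State : Set
State = List ℕ × (ℕ → ℕ)

-- A stack too short for the move is left unchanged; the invariant below
-- shows that this never happens.
applyMove : Move → ℕ → List ℕ → (ℕ → ℕ) → State
applyMove push i stk f = i ∷ stk , f
applyMove popTop i (a ∷ stk) f = stk , link f i a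
applyMove popSecond i (b ∷ a ∷ stk) f = b ∷ stk , link f i a
applyMove _ _ stk f = stk , f

module Decoding (m : ℕ) (T : ℕ → List ℕ) where

  Grows : ℕ → Set
  Grows i = size (T i) < size (T (suc i))

  move : ℕ → Move
  move i with size (T i) <? size (T (suc i)) | isHook (T i)
  ... | yes _ | _ = push
  ... | no _ | true = popSecond
  ... | no _ | false = popTop

  data MoveView (i : ℕ) : Move → Set where
    grows        : Grows i → MoveView i push
    shrinks-hook : ¬ Grows i → isHook (T i) ≡ true → MoveView i popSecond
    shrinks-row  : ¬ Grows i → isHook (T i) ≡ false → MoveView i popTop

  move-view : ∀ i → MoveView i (move i)
  move-view i with size (T i) <? size (T (suc i)) | isHook (T i) in hook
  ... | yes g | _ = grows g
  ... | no ¬g | true = shrinks-hook ¬g hook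
  ... | no ¬g | false = shrinks-row ¬g hook

  push⇒grows : ∀ i → move i ≡ push → Grows i
  push⇒grows i eq with move i | move-view i
  push⇒grows i refl | _ | grows g = g

  grows⇒push : ∀ i → Grows i → move i ≡ push
  grows⇒push i g with move i | move-view i
  ... | _ | grows _ = refl
  ... | _ | shrinks-hook ¬g _ = contradiction g ¬g
  ... | _ | shrinks-row ¬g _ = contradiction g ¬g

  ¬push⇒¬grows : ∀ i → move i ≢ push → ¬ Grows i
  ¬push⇒¬grows i ¬push g = ¬push (grows⇒push i g)

  popSecond⇒hook : ∀ i → move i ≡ popSecond → isHook (T i) ≡ true
  popSecond⇒hook i eq with move i | move-view i
  popSecond⇒hook i refl | _ | shrinks-hook _ hook = hook

  shrinking-hook⇒popSecond : ∀ i → ¬ Grows i → isHook (T i) ≡ true → move i ≡ popSecond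
  shrinking-hook⇒popSecond i ¬g hook with move i | move-view i
  ... | _ | grows g = contradiction g ¬g
  ... | _ | shrinks-hook _ _ = refl
  ... | _ | shrinks-row _ row = contradiction (trans (sym hook) row) λ ()

  state : ℕ → State
  state zero = [] , id
  state (suc i) = applyMove (move i) i (proj₁ (state i)) (proj₂ (state i))

  stack : ℕ → List ℕ
  stack i = proj₁ (state i)

  partial : ℕ → ℕ → ℕ
  partial i = proj₂ (state i)

  decoded : ℕ → ℕ
  decoded = partial m

  AfterPushOrSecond : ℕ → Set
  AfterPushOrSecond zero = ⊥
  AfterPushOrSecond (suc i) = move i ≡ push ⊎ move i ≡ popSecond

  record Settled (f : ℕ → ℕ) (i y : ℕ) : Set where
    field
      partner<   : f y < i
      involutive : f (f y) ≡ y
      oriented   : (y < f y × move y ≡ push) ⊎ (f y < y × move y ≢ push)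

    moved : f y ≢ y
    moved fy≡y with oriented
    ... | inj₁ (y<fy , _) = <-irrefl (sym fy≡y) y<fy
    ... | inj₂ (fy<y , _) = <-irrefl fy≡y fy<y

  record Invariant (i : ℕ) (σ : State) : Set where
    field
      descending : AllPairs _>_ (proj₁ σ)
      below      : All (_< i) (proj₁ σ)
      pending    : ∀ y → y ∈ proj₁ σ → move y ≡ push × proj₂ σ y ≡ y
      covered    : ∀ y → y < i → y ∈ proj₁ σ ⊎ Settled (proj₂ σ) i y
      untouched  : ∀ y → i ≤ y → proj₂ σ y ≡ y
      height     : length (proj₁ σ) ≡ size (T i)
      -- This clause is what rules out 12312 in the decoded matching.
      run        : AfterPushOrSecond i →
                   ∃₂ λ top rest → proj₁ σ ≡ top ∷ rest × (∀ z → top < z → z < i → move z ≡ popSecond)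

  module _ (R : IsRestrictedTableau m T) where
    open IsRestrictedTableau R
    open RestrictedTableau R

    push⇒size : ∀ i → i < m → move i ≡ push → size (T (suc i)) ≡ suc (size (T i))
    push⇒size i i<m eq = grow-size i i<m (push⇒grows i eq)

    pop⇒size : ∀ i → i < m → move i ≢ push → size (T i) ≡ suc (size (T (suc i)))
    pop⇒size i i<m ¬push = shrink-size i i<m (¬push⇒¬grows i ¬push)

    popSecond⇒2≤size : ∀ i → i < m → move i ≡ popSecond → 2 ≤ size (T i)
    popSecond⇒2≤size i i<m eq = hook⇒2≤size i (<⇒≤ i<m) (popSecond⇒hook i eq)

    popSecond⇒after : ∀ i → i < m → move i ≡ popSecond → AfterPushOrSecond i
    popSecond⇒after zero _ eq = contradiction (trans (sym (cong isHook starts-empty)) (popSecond⇒hook 0 eq)) λ ()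
    popSecond⇒after (suc i) 1+i<m eq with oscStep i (<⇒≤ 1+i<m)
    ... | inj₁ (_ , bigger) = inj₁ (grows⇒push i (subst (size (T i) <_) (sym bigger) (n<1+n _)))
    ... | inj₂ ⊂@(_ , smaller) = inj₂ (shrinking-hook⇒popSecond i
          (λ g → <-asym g (subst (size (T (suc i)) <_) (sym smaller) (n<1+n _)))
          (shrink-to-hook i (<⇒≤ 1+i<m) (popSecond⇒hook (suc i) eq) ⊂))

    invariant-zero : Invariant 0 (state 0)
    invariant-zero = record
      { descending = [] ; below = [] ; pending = λ _ () ; covered = λ _ () ; untouched = λ _ _ → refl
      ; height = sym (cong size starts-empty) ; run = λ () }

    settled-suc : ∀ {f i y} → Settled f i y → Settled f (suc i) y
    settled-suc s = record { partner< = m<n⇒m<1+n partner< ; involutive = involutive ; oriented = oriented }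
      where open Settled s

    settled-link : ∀ {i stk f a y} → Invariant i (stk , f) → a ∈ stk → Settled f i y →
      link f i a y ≡ f y × Settled (link f i a) (suc i) y
    settled-link {i} {stk} {f} {a} {y} I a∈stk s = fixed , record
      { partner< = subst (_< suc i) (sym fixed) (m<n⇒m<1+n partner<)
      ; involutive = trans (cong (link f i a) fixed) (trans fixed′ involutive)
      ; oriented = subst (λ z → (y < z × move y ≡ push) ⊎ (z < y × move y ≢ push)) (sym fixed) oriented }
      where
      open Invariant I
      open Settled s
      fa≡a : f a ≡ a
      fa≡a = proj₂ (pending a a∈stk)
      y<i : y < i
      y<i = ≰⇒> λ i≤y → moved (untouched y i≤y)
      y≢a : y ≢ a
      y≢a y≡a = moved (trans (cong f y≡a) (trans fa≡a (sym y≡a)))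
      fy≢a : f y ≢ a
      fy≢a fy≡a = y≢a (trans (sym involutive) (trans (cong f fy≡a) fa≡a))
      fixed : link f i a y ≡ f y
      fixed = link-elsewhere f i a y (<⇒≢ y<i) y≢a
      fixed′ : link f i a (f y) ≡ f (f y)
      fixed′ = link-elsewhere f i a (f y) (<⇒≢ partner<) fy≢a

    linked-closer-settled : ∀ {i stk f a} → Invariant i (stk , f) → a ∈ stk → move i ≢ push → Settled (link f i a) (suc i) i
    linked-closer-settled {i} {f = f} {a} I a∈stk ¬push = record
      { partner< = subst (_< suc i) (sym linked) (m<n⇒m<1+n a<i)
      ; involutive = trans (cong (link f i a) linked) (link-there f i a)
      ; oriented = inj₂ (subst (_< i) (sym linked) a<i , ¬push) }
      where
      a<i = All.lookup (Invariant.below I) a∈stk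
      linked = link-here f i a (<⇒≢ a<i)

    linked-opener-settled : ∀ {i stk f a} → Invariant i (stk , f) → a ∈ stk → Settled (link f i a) (suc i) a
    linked-opener-settled {i} {f = f} {a} I a∈stk = record
      { partner< = subst (_< suc i) (sym (link-there f i a)) (n<1+n i)
      ; involutive = trans (cong (link f i a) (link-there f i a)) (link-here f i a (<⇒≢ a<i))
      ; oriented = inj₁ (subst (a <_) (sym (link-there f i a)) a<i , proj₁ (Invariant.pending I a a∈stk)) }
      where
      a<i = All.lookup (Invariant.below I) a∈stk

    invariant-pop : ∀ i {stk f a} stk′ → i < m → move i ≢ push → Invariant i (stk , f) → a ∈ stk →
      (∀ y → y ∈ stk′ → y ∈ stk × y ≢ a) → (∀ y → y ∈ stk → y ≢ a → y ∈ stk′) → AllPairs _>_ stk′ →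
      length stk ≡ suc (length stk′) →
      (AfterPushOrSecond (suc i) →
        ∃₂ λ top rest → stk′ ≡ top ∷ rest × (∀ z → top < z → z < suc i → move z ≡ popSecond)) →
      Invariant (suc i) (stk′ , link f i a)
    invariant-pop i {stk} {f} {a} stk′ i<m ¬push I a∈stk kept restored descending′ popped run′ = record
      { descending = descending′
      ; below = All.tabulate (λ y∈ → m<n⇒m<1+n (All.lookup below (proj₁ (kept _ y∈))))
      ; pending = pending′
      ; covered = covered′
      ; untouched = untouched′
      ; height = suc-injective (trans (sym popped) (trans height (pop⇒size i i<m ¬push)))
      ; run = run′ }
      where
      open Invariant I
      f′ = link f i a
      a<i : a < i
      a<i = All.lookup below a∈stk
      pending′ : ∀ y → y ∈ stk′ → move y ≡ push × f′ y ≡ y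
      pending′ y y∈ with kept y y∈
      ... | y∈stk , y≢a = proj₁ (pending y y∈stk) ,
            trans (link-elsewhere f i a y (<⇒≢ (All.lookup below y∈stk)) y≢a) (proj₂ (pending y y∈stk))
      covered′ : ∀ y → y < suc i → y ∈ stk′ ⊎ Settled f′ (suc i) y
      covered′ y y<1+i with m<1+n⇒m<n∨m≡n y<1+i
      ... | inj₂ refl = inj₂ (linked-closer-settled I a∈stk ¬push)
      ... | inj₁ y<i with covered y y<i | y ≟ a
      ...   | inj₂ s | _ = inj₂ (proj₂ (settled-link I a∈stk s))
      ...   | inj₁ _ | yes refl = inj₂ (linked-opener-settled I a∈stk)
      ...   | inj₁ y∈stk | no y≢a = inj₁ (restored y y∈stk y≢a)
      untouched′ : ∀ y → suc i ≤ y → f′ y ≡ y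
      untouched′ y i<y = trans (link-elsewhere f i a y (≢-sym (<⇒≢ i<y)) (≢-sym (<⇒≢ (<-trans a<i i<y))))
                               (untouched y (<⇒≤ i<y))

    invariant-push : ∀ i {stk f} → i < m → move i ≡ push → Invariant i (stk , f) → Invariant (suc i) (i ∷ stk , f)
    invariant-push i {stk} {f} i<m eq I = record
      { descending = below ∷ descending
      ; below = n<1+n i ∷ All.map m<n⇒m<1+n below
      ; pending = λ { y (here refl) → eq , untouched i ≤-refl ; y (there y∈) → pending y y∈ }
      ; covered = covered′
      ; untouched = λ y i<y → untouched y (<⇒≤ i<y)
      ; height = trans (cong suc height) (sym (push⇒size i i<m eq))
      ; run = λ _ → i , stk , refl , λ z i<z z<1+i → contradiction (≤-pred z<1+i) (<⇒≱ i<z) }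
      where
      open Invariant I
      covered′ : ∀ y → y < suc i → y ∈ i ∷ stk ⊎ Settled f (suc i) y
      covered′ y y<1+i with m<1+n⇒m<n∨m≡n y<1+i
      ... | inj₂ refl = inj₁ (here refl)
      ... | inj₁ y<i with covered y y<i
      ...   | inj₁ y∈ = inj₁ (there y∈)
      ...   | inj₂ s = inj₂ (settled-suc s)

    invariant-step : ∀ i σ → i < m → Invariant i σ → Invariant (suc i) (applyMove (move i) i (proj₁ σ) (proj₂ σ))
    invariant-step i (stk , f) i<m I with move i in eq
    ... | push = invariant-push i i<m eq I
    invariant-step i ([] , f) i<m I | popTop =
      contradiction (trans (Invariant.height I) (pop⇒size i i<m (subst (_≢ push) (sym eq) λ ()))) 0≢1+n
    invariant-step i (a ∷ rest , f) i<m I | popTop =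
      invariant-pop i rest i<m (subst (_≢ push) (sym eq) λ ()) I (here refl)
        (λ y y∈ → there y∈ , λ y≡a → <-irrefl y≡a (All.lookup a>rest y∈))
        (λ { y (here refl) y≢a → contradiction refl y≢a ; y (there y∈) _ → y∈ })
        rest-descending refl
        (λ { (inj₁ pushed) → ⊥-elim (subst (_≢ push) (sym eq) (λ ()) pushed) ; (inj₂ second) → ⊥-elim (subst (_≢ popSecond) (sym eq) (λ ()) second) })
      where
      open Invariant I
      a>rest = AllPairs.head descending
      rest-descending = AllPairs.tail descending
    invariant-step i ([] , f) i<m I | popSecond =
      contradiction (subst (2 ≤_) (sym (Invariant.height I)) (popSecond⇒2≤size i i<m eq)) λ ()
    invariant-step i (_ ∷ [] , f) i<m I | popSecond =
      contradiction (subst (2 ≤_) (sym (Invariant.height I)) (popSecond⇒2≤size i i<m eq)) λ { (s≤s ()) }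
    invariant-step i (b ∷ a ∷ rest , f) i<m I | popSecond =
      invariant-pop i (b ∷ rest) i<m (subst (_≢ push) (sym eq) λ ()) I (there (here refl))
        (λ { y (here refl) → here refl , λ b≡a → <-irrefl (sym b≡a) b>a
           ; y (there y∈) → there (there y∈) , λ y≡a → <-irrefl y≡a (All.lookup a>rest y∈) })
        (λ { y (here refl) _ → here refl ; y (there (here refl)) y≢a → contradiction refl y≢a
           ; y (there (there y∈)) _ → there y∈ })
        (All.tail b>a∷rest ∷ AllPairs.tail (AllPairs.tail descending)) refl run′
      where
      open Invariant I
      b>a∷rest = AllPairs.head descending
      b>a = All.head b>a∷rest
      a>rest = AllPairs.head (AllPairs.tail descending)
      run′ : AfterPushOrSecond (suc i) →
        ∃₂ λ top rest′ → b ∷ rest ≡ top ∷ rest′ × (∀ z → top < z → z < suc i → move z ≡ popSecond)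
      run′ _ with run (popSecond⇒after i i<m eq)
      ... | _ , _ , refl , popSeconds = b , rest , refl , λ z b<z z<1+i → case m<1+n⇒m<n∨m≡n z<1+i of λ
            { (inj₁ z<i) → popSeconds z b<z z<i ; (inj₂ refl) → eq }

    invariant : ∀ i → i ≤ m → Invariant i (state i)
    invariant zero _ = invariant-zero
    invariant (suc i) i<m = invariant-step i (state i) i<m (invariant i (<⇒≤ i<m))

    settled-step : ∀ i σ y → Invariant i σ → Settled (proj₂ σ) i y →
      proj₂ (applyMove (move i) i (proj₁ σ) (proj₂ σ)) y ≡ proj₂ σ y × Settled (proj₂ (applyMove (move i) i (proj₁ σ) (proj₂ σ))) (suc i) y
    settled-step i σ y I s with move i
    settled-step i (stk , f) y I s | push = refl , settled-suc s
    settled-step i ([] , f) y I s | popTop = refl , settled-suc s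
    settled-step i (a ∷ _ , f) y I s | popTop = settled-link I (here refl) s
    settled-step i ([] , f) y I s | popSecond = refl , settled-suc s
    settled-step i (_ ∷ [] , f) y I s | popSecond = refl , settled-suc s
    settled-step i (_ ∷ a ∷ _ , f) y I s | popSecond = settled-link I (there (here refl)) s

    settled-later : ∀ d i y → d + i ≤ m → Settled (partial i) i y →
      partial (d + i) y ≡ partial i y × Settled (partial (d + i)) (d + i) y
    settled-later zero i y _ s = refl , s
    settled-later (suc d) i y d+i<m s with settled-later d i y (<⇒≤ d+i<m) s
    ... | unchanged , s′ with settled-step (d + i) (state (d + i)) y (invariant (d + i) (<⇒≤ d+i<m)) s′
    ...   | unchanged′ , s″ = trans unchanged′ unchanged , s″

    settled⇒decoded : ∀ i y → i ≤ m → Settled (partial i) i y → decoded y ≡ partial i y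
    settled⇒decoded i y i≤m s = trans (cong (λ k → partial k y) (sym m∸i+i≡m))
                                      (proj₁ (settled-later (m ∸ i) i y (≤-reflexive m∸i+i≡m) s))
      where
      m∸i+i≡m : m ∸ i + i ≡ m
      m∸i+i≡m = m∸n+n≡m i≤m

    all-settled : ∀ y → y < m → Settled decoded m y
    all-settled y y<m with Invariant.covered (invariant m ≤-refl) y y<m
    ... | inj₂ s = s
    ... | inj₁ y∈ = contradiction (trans (Invariant.height (invariant m ≤-refl)) (cong size ends-empty)) (∈⇒length≢0 y∈)

    decoded-isMatching : IsMatchingOn m decoded
    decoded-isMatching = record
      { partner<m = λ y y<m → Settled.partner< (all-settled y y<m)
      ; involutive = λ y y<m → Settled.involutive (all-settled y y<m)
      ; fixpoint-free = λ y y<m → Settled.moved (all-settled y y<m) }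

    opens⇒push : ∀ y → y < m → y < decoded y → move y ≡ push
    opens⇒push y y<m y-opens with Settled.oriented (all-settled y y<m)
    ... | inj₁ (_ , pushed) = pushed
    ... | inj₂ (closes , _) = contradiction closes (<-asym y-opens)

    push⇒opens : ∀ y → y < m → move y ≡ push → y < decoded y
    push⇒opens y y<m pushed with Settled.oriented (all-settled y y<m)
    ... | inj₁ (opens , _) = opens
    ... | inj₂ (_ , ¬pushed) = contradiction pushed ¬pushed

    settled-after-pop : ∀ i → i < m → move i ≢ push → Settled (partial (suc i)) (suc i) i
    settled-after-pop i i<m ¬push with Invariant.covered (invariant (suc i) i<m) i (n<1+n i)
    ... | inj₂ s = s
    ... | inj₁ i∈ = contradiction (proj₁ (Invariant.pending (invariant (suc i) i<m) i i∈)) ¬push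

    popTop-links : ∀ i σ → Invariant i σ → i < m → move i ≡ popTop →
      ∃₂ λ a rest → proj₁ σ ≡ a ∷ rest × proj₂ (applyMove (move i) i (proj₁ σ) (proj₂ σ)) i ≡ a
    popTop-links i ([] , f) I i<m eq =
      contradiction (trans (Invariant.height I) (pop⇒size i i<m (subst (_≢ push) (sym eq) λ ()))) 0≢1+n
    popTop-links i (a ∷ rest , f) I i<m eq rewrite eq =
      a , rest , refl , link-here f i a (<⇒≢ (All.head (Invariant.below I)))

    popSecond-links : ∀ i σ → Invariant i σ → i < m → move i ≡ popSecond →
      ∃₂ λ b a → ∃ λ rest → proj₁ σ ≡ b ∷ a ∷ rest × proj₂ (applyMove (move i) i (proj₁ σ) (proj₂ σ)) i ≡ a
    popSecond-links i ([] , f) I i<m eq =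
      contradiction (subst (2 ≤_) (sym (Invariant.height I)) (popSecond⇒2≤size i i<m eq)) λ ()
    popSecond-links i (_ ∷ [] , f) I i<m eq =
      contradiction (subst (2 ≤_) (sym (Invariant.height I)) (popSecond⇒2≤size i i<m eq)) λ { (s≤s ()) }
    popSecond-links i (b ∷ a ∷ rest , f) I i<m eq rewrite eq =
      b , a , rest , refl , link-here f i a (<⇒≢ (All.head (All.tail (Invariant.below I))))

    popTop-partner : ∀ i → i < m → move i ≡ popTop → ∃₂ λ a rest → stack i ≡ a ∷ rest × decoded i ≡ a
    popTop-partner i i<m eq with popTop-links i (state i) (invariant i (<⇒≤ i<m)) i<m eq
    ... | a , rest , stack≡ , linked = a , rest , stack≡ ,
          trans (settled⇒decoded (suc i) i i<m (settled-after-pop i i<m (subst (_≢ push) (sym eq) λ ()))) linked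

    popSecond-partner : ∀ i → i < m → move i ≡ popSecond →
      ∃₂ λ b a → ∃ λ rest → stack i ≡ b ∷ a ∷ rest × decoded i ≡ a
    popSecond-partner i i<m eq with popSecond-links i (state i) (invariant i (<⇒≤ i<m)) i<m eq
    ... | b , a , rest , stack≡ , linked = b , a , rest , stack≡ ,
          trans (settled⇒decoded (suc i) i i<m (settled-after-pop i i<m (subst (_≢ push) (sym eq) λ ()))) linked

    stack-step : ∀ i σ y → Invariant i σ → Invariant (suc i) (applyMove (move i) i (proj₁ σ) (proj₂ σ)) → y ∈ proj₁ σ →
      y ∈ proj₁ (applyMove (move i) i (proj₁ σ) (proj₂ σ)) ⊎
      (proj₂ (applyMove (move i) i (proj₁ σ) (proj₂ σ)) y ≡ i × Settled (proj₂ (applyMove (move i) i (proj₁ σ) (proj₂ σ))) (suc i) y)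
    stack-step i σ y I I′ y∈ with move i
    stack-step i (stk , f) y I I′ y∈ | push = inj₁ (there y∈)
    stack-step i (a ∷ _ , f) y I I′ (here refl) | popTop with Invariant.covered I′ a (m<n⇒m<1+n (All.head (Invariant.below I)))
    ... | inj₂ s = inj₂ (link-there f i a , s)
    ... | inj₁ a∈rest = contradiction (All.lookup (AllPairs.head (Invariant.descending I)) a∈rest) (<-irrefl refl)
    stack-step i (a ∷ _ , f) y I I′ (there y∈) | popTop = inj₁ y∈
    stack-step i ([] , f) y I I′ y∈ | popSecond = inj₁ y∈
    stack-step i (_ ∷ [] , f) y I I′ y∈ | popSecond = inj₁ y∈
    stack-step i (b ∷ a ∷ _ , f) y I I′ (here refl) | popSecond = inj₁ (here refl)
    stack-step i (b ∷ a ∷ _ , f) y I I′ (there (here refl)) | popSecond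
      with Invariant.covered I′ a (m<n⇒m<1+n (All.head (All.tail (Invariant.below I))))
    ... | inj₂ s = inj₂ (link-there f i a , s)
    ... | inj₁ (here a≡b) = contradiction (All.head (AllPairs.head (Invariant.descending I))) (<-irrefl a≡b)
    ... | inj₁ (there a∈rest) = contradiction (All.lookup (AllPairs.head (AllPairs.tail (Invariant.descending I))) a∈rest) (<-irrefl refl)
    stack-step i (b ∷ a ∷ _ , f) y I I′ (there (there y∈)) | popSecond = inj₁ (there y∈)

    stacked⇒still-open : ∀ i y → i ≤ m → y ∈ stack i → i ≤ decoded y
    stacked⇒still-open i y i≤m = go (m ∸ i) i (m∸n+n≡m i≤m)
      where
      go : ∀ d i → d + i ≡ m → y ∈ stack i → i ≤ decoded y
      go zero .m refl y∈ = contradiction (trans (Invariant.height (invariant m ≤-refl)) (cong size ends-empty)) (∈⇒length≢0 y∈)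
      go (suc d) i d+i≡m y∈ = after-step (stack-step i (state i) y (invariant i (<⇒≤ i<m)) (invariant (suc i) i<m) y∈)
        where
        i<m : i < m
        i<m = subst (i <_) d+i≡m (s≤s (m≤n+m i d))
        after-step : y ∈ stack (suc i) ⊎ (partial (suc i) y ≡ i × Settled (partial (suc i)) (suc i) y) → i ≤ decoded y
        after-step (inj₁ y∈′) = <⇒≤ (go d (suc i) (trans (+-suc d i) d+i≡m) y∈′)
        after-step (inj₂ (linked , s)) = ≤-reflexive (sym (trans (settled⇒decoded (suc i) y i<m s) linked))

    still-open⇒stacked : ∀ i y → i ≤ m → y < i → i ≤ decoded y → y ∈ stack i
    still-open⇒stacked i y i≤m y<i i≤Dy with Invariant.covered (invariant i i≤m) y y<i
    ... | inj₁ y∈ = y∈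
    ... | inj₂ s = contradiction i≤Dy (<⇒≱ (subst (_< i) (sym (settled⇒decoded i y i≤m s)) (Settled.partner< s)))

    stacked-above-partner : ∀ i y → i < m → y ∈ stack i → decoded i < y →
      move i ≡ popSecond × ∃ λ rest → stack i ≡ y ∷ rest
    stacked-above-partner i y i<m y∈ Di<y with move i in eq
    ... | push = contradiction (<-trans (All.lookup (Invariant.below (invariant i (<⇒≤ i<m))) y∈) (push⇒opens i i<m eq)) (<-asym Di<y)
    ... | popTop with popTop-partner i i<m eq
    ...   | a , rest , stack≡ , Di≡a with subst (y ∈_) stack≡ y∈ | subst (AllPairs _>_) stack≡ (Invariant.descending (invariant i (<⇒≤ i<m)))
    ...     | here refl | _ = contradiction Di≡a (<⇒≢ Di<y)
    ...     | there y∈rest | a>rest ∷ _ = contradiction (subst (_< y) Di≡a Di<y) (<-asym (All.lookup a>rest y∈rest))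
    stacked-above-partner i y i<m y∈ Di<y | popSecond with popSecond-partner i i<m eq
    ...   | b , a , rest , stack≡ , Di≡a with subst (y ∈_) stack≡ y∈ | subst (AllPairs _>_) stack≡ (Invariant.descending (invariant i (<⇒≤ i<m)))
    ...     | here refl | _ = refl , a ∷ rest , stack≡
    ...     | there (here refl) | _ = contradiction Di≡a (<⇒≢ Di<y)
    ...     | there (there y∈rest) | _ ∷ a>rest ∷ _ = contradiction (subst (_< y) Di≡a Di<y) (<-asym (All.lookup a>rest y∈rest))

module Decoded {m : ℕ} {T : ℕ → List ℕ} (R : IsRestrictedTableau m T) where
  open IsRestrictedTableau R
  open RestrictedTableau R
  open Decoding m T
  open Tableau m decoded
  D = decoded-isMatching R

  openCount-decoded : ∀ i → i ≤ m → openCount i ≡ size (T i)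
  openCount-decoded zero _ = trans (openCount-zero D) (sym (cong size starts-empty))
  openCount-decoded (suc i) i<m with i <? decoded i
  ... | yes opens = begin
    openCount (suc i)    ≡⟨ openCount-opener D i i<m opens ⟩
    suc (openCount i)    ≡⟨ cong suc (openCount-decoded i (<⇒≤ i<m)) ⟩
    suc (size (T i))     ≡⟨ push⇒size R i i<m (opens⇒push R i i<m opens) ⟨
    size (T (suc i))     ∎
    where open ≡-Reasoning
  ... | no ¬opens = suc-injective (begin
    suc (openCount (suc i)) ≡⟨ openCount-closer D i i<m ¬opens ⟨
    openCount i             ≡⟨ openCount-decoded i (<⇒≤ i<m) ⟩
    size (T i)              ≡⟨ pop⇒size R i i<m (λ pushed → ¬opens (push⇒opens R i i<m pushed)) ⟩
    suc (size (T (suc i)))  ∎)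
    where open ≡-Reasoning

  popSecond⇒crossed : ∀ i → i < m → move i ≡ popSecond → Crossed i
  popSecond⇒crossed i i<m eq with popSecond-partner R i i<m eq
  ... | b , a , rest , stack≡ , Di≡a =
    i<m , subst (_< i) (sym Di≡a) a<i , b , b<i , subst (_< b) (sym Di≡a) a<b ,
    stacked⇒still-open R (suc i) b i<m b∈stack
    where
    I = invariant R i (<⇒≤ i<m)
    below = subst (All (_< i)) stack≡ (Invariant.below I)
    a<i = All.head (All.tail below)
    b<i = All.head below
    a<b = All.head (AllPairs.head (subst (AllPairs _>_) stack≡ (Invariant.descending I)))
    b∈stack : b ∈ stack (suc i)
    b∈stack rewrite eq | stack≡ = here refl

  crossed⇒popSecond : ∀ i → i < m → Crossed i → move i ≡ popSecond
  crossed⇒popSecond i i<m (_ , _ , j , j<i , Di<j , i<Dj) =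
    proj₁ (stacked-above-partner R i j i<m (still-open⇒stacked R i j (<⇒≤ i<m) j<i (<⇒≤ i<Dj)) Di<j)

  hook-decoded : ∀ i → i ≤ m → does (crossed? i) ≡ isHook (T i)
  hook-decoded i i≤m with m≤n⇒m<n∨m≡n i≤m
  ... | inj₂ refl = trans (dec-false (crossed? i) (λ crossed → <-irrefl refl (proj₁ crossed))) (sym (cong isHook ends-empty))
  ... | inj₁ i<m with isHook (T i) in hook
  ...   | true = dec-true (crossed? i) (popSecond⇒crossed i i<m (shrinking-hook⇒popSecond i (hook⇒shrinks i i<m hook) hook))
  ...   | false = dec-false (crossed? i) (λ crossed → contradiction (trans (sym hook) (popSecond⇒hook i (crossed⇒popSecond i i<m crossed))) λ ())

  shapeAt-decoded : ∀ i → i ≤ m → shapeAt i ≡ T i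
  shapeAt-decoded i i≤m rewrite openCount-decoded i i≤m | hook-decoded i i≤m = shape-of (T i) (rowOrHook i i≤m)

  -- The letter 3 sits between x₂ and x₄ and opens an arc, but x₄ is a popSecond
  -- with x₂ on top of the stack, so every position strictly between them is a popSecond.
  decoded-avoids : ¬ Occurrence12312 m decoded
  decoded-avoids (occurrence x₁ x₂ x₃ x₄ x₅ x₁<x₂ x₂<x₃ x₃<x₄ x₄<x₅ x₅<m arc₁₄ arc₂₅ x₃-opens) =
    excluded (stacked-above-partner R x₄ x₂ x₄<m x₂∈stack (subst (_< x₂) (sym Dx₄≡x₁) x₁<x₂))
    where
    x₄<m = <-trans x₄<x₅ x₅<m
    Dx₄≡x₁ : decoded x₄ ≡ x₁
    Dx₄≡x₁ = IsMatchingOn.partner-sym D (<-trans (<-trans x₁<x₂ (<-trans x₂<x₃ x₃<x₄)) x₄<m) arc₁₄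
    x₂∈stack : x₂ ∈ stack x₄
    x₂∈stack = still-open⇒stacked R x₄ x₂ (<⇒≤ x₄<m) (<-trans x₂<x₃ x₃<x₄) (subst (x₄ ≤_) (sym arc₂₅) (<⇒≤ x₄<x₅))
    x₃-pushed : move x₃ ≡ push
    x₃-pushed = opens⇒push R x₃ (<-trans x₃<x₄ x₄<m) x₃-opens
    excluded : move x₄ ≡ popSecond × (∃ λ rest → stack x₄ ≡ x₂ ∷ rest) → ⊥
    excluded (popSecond! , rest , stack≡) with Invariant.run (invariant R x₄ (<⇒≤ x₄<m)) (popSecond⇒after R x₄ x₄<m popSecond!)
    ... | top , _ , stack≡′ , popSeconds =
          contradiction (trans (sym x₃-pushed) (popSeconds x₃ top<x₃ x₃<x₄)) λ ()
      where
      top<x₃ : top < x₃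
      top<x₃ = subst (_< x₃) (ListP.∷-injectiveˡ (trans (sym stack≡) stack≡′)) x₂<x₃

module _ {m : ℕ} {P Q : ℕ → ℕ} (agree : ∀ x → x < m → P x ≡ Q x) where
  private
    module TP = Tableau m P
    module TQ = Tableau m Q

  openAt-transfer : ∀ i y → y < m → TP.OpenAt i y → TQ.OpenAt i y
  openAt-transfer i y y<m = subst (λ z → y < i × y < z × i ≤ z) (agree y y<m)

  crossed-transfer : ∀ i → TP.Crossed i → TQ.Crossed i
  crossed-transfer i (i<m , Pi<i , j , j<i , Pi<j , i<Pj) =
    i<m , subst (_< i) Pi≡Qi Pi<i , j , j<i , subst (_< j) Pi≡Qi Pi<j , subst (i <_) (agree j (<-trans j<i i<m)) i<Pj
    where Pi≡Qi = agree i i<m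

  occurrence-transfer : Occurrence12312 m P → Occurrence12312 m Q
  occurrence-transfer (occurrence x₁ x₂ x₃ x₄ x₅ x₁<x₂ x₂<x₃ x₃<x₄ x₄<x₅ x₅<m arc₁₄ arc₂₅ x₃-opens) =
    occurrence x₁ x₂ x₃ x₄ x₅ x₁<x₂ x₂<x₃ x₃<x₄ x₄<x₅ x₅<m
      (trans (sym (agree x₁ x₁<m)) arc₁₄) (trans (sym (agree x₂ x₂<m)) arc₂₅) (subst (x₃ <_) (agree x₃ x₃<m) x₃-opens)
    where
    x₃<m = <-trans x₃<x₄ (<-trans x₄<x₅ x₅<m)
    x₂<m = <-trans x₂<x₃ x₃<m
    x₁<m = <-trans x₁<x₂ x₂<m

shapeAt-cong : ∀ {m P Q} → (∀ x → x < m → P x ≡ Q x) → ∀ i → Tableau.shapeAt m P i ≡ Tableau.shapeAt m Q i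
shapeAt-cong {m} {P} {Q} agree i = cong₂ shape
  (count-cong (Tableau.openAt? m P i) (Tableau.openAt? m Q i) m (openAt-transfer agree i) (openAt-transfer agree′ i))
  (does-⇔ (mk⇔ (crossed-transfer agree i) (crossed-transfer agree′ i)) (Tableau.crossed? m P i) (Tableau.crossed? m Q i))
  where
  agree′ : ∀ x → x < m → Q x ≡ P x
  agree′ x x<m = sym (agree x x<m)

tabulateℕ : {A : Set} {k : ℕ} → (ℕ → A) → Vec A k
tabulateℕ f = tabulate (f ∘ toℕ)

lookup-tabulateℕ : {A : Set} {k : ℕ} (f : ℕ → A) (i : Fin k) → lookup (tabulateℕ f) i ≡ f (toℕ i)
lookup-tabulateℕ f = VecP.lookup∘tabulate (f ∘ toℕ)

lookupℕ-tabulateℕ : {A : Set} {k : ℕ} (d : A) (f : ℕ → A) {i : ℕ} → i < k → lookupℕ d (tabulateℕ {k = k} f) i ≡ f i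
lookupℕ-tabulateℕ {A} {k} d f {i} i<k = begin
  lookupℕ d v i        ≡⟨ cong (lookupℕ d v) (toℕ-fromℕ< i<k) ⟨
  lookupℕ d v (toℕ j)  ≡⟨ lookupℕ-toℕ d v j ⟩
  lookup v j           ≡⟨ lookup-tabulateℕ f j ⟩
  f (toℕ j)            ≡⟨ cong f (toℕ-fromℕ< i<k) ⟩
  f i                  ∎
  where
  open ≡-Reasoning
  v : Vec A k
  v = tabulateℕ f
  j = fromℕ< i<k

lookup-extensionality : {A : Set} {k : ℕ} (xs ys : Vec A k) → (∀ i → lookup xs i ≡ lookup ys i) → xs ≡ ys
lookup-extensionality xs ys eq = begin
  xs                  ≡⟨ VecP.tabulate∘lookup xs ⟨
  tabulate (lookup xs) ≡⟨ VecP.tabulate-cong eq ⟩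
  tabulate (lookup ys) ≡⟨ VecP.tabulate∘lookup ys ⟩
  ys                  ∎
  where open ≡-Reasoning

RestrictedTableauVec : (m : ℕ) → Vec (List ℕ) (suc m) → Set
RestrictedTableauVec m t = IsOscillatingTableau m t × ((i : Fin (suc m)) → RowOrHook (lookup t i)) × NoHookGrowth m t

module _ {m : ℕ} {T : ℕ → List ℕ} (R : IsRestrictedTableau m T) where
  open IsRestrictedTableau R

  tabulateℕ-restricted : RestrictedTableauVec m (tabulateℕ T)
  tabulateℕ-restricted =
    ( (λ i → rowOrHook⇒isPartition (rowOrHook-at i))
    , trans (lookup-tabulateℕ {k = suc m} T fzero) starts-empty
    , trans (lookup-tabulateℕ T (fromℕ m)) (trans (cong T (toℕ-fromℕ m)) ends-empty)
    , λ i → subst₂ OscStep (sym (at-inject₁ i)) (sym (lookup-tabulateℕ T (fsuc i))) (oscStep (toℕ i) (toℕ<n i)) )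
    , rowOrHook-at
    , λ i k 1≤k hook hook′ → noHookGrowth (toℕ i) (toℕ<n i) k 1≤k (trans (sym (at-inject₁ i)) hook)
                               (trans (sym (lookup-tabulateℕ T (fsuc i))) hook′)
    where
    rowOrHook-at : (i : Fin (suc m)) → RowOrHook (lookup (tabulateℕ T) i)
    rowOrHook-at i = subst RowOrHook (sym (lookup-tabulateℕ T i)) (rowOrHook (toℕ i) (≤-pred (toℕ<n i)))
    at-inject₁ : (i : Fin m) → lookup (tabulateℕ T) (inject₁ i) ≡ T (toℕ i)
    at-inject₁ i = trans (lookup-tabulateℕ T (inject₁ i)) (cong T (toℕ-inject₁ i))

lookupℕ-restricted : ∀ {m} (t : Vec (List ℕ) (suc m)) → RestrictedTableauVec m t → IsRestrictedTableau m (lookupℕ [] t)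
lookupℕ-restricted {m} t ((_ , empty₀ , emptyₘ , steps) , rowOrHook , noHookGrowth) = record
  { starts-empty = trans (lookupℕ-toℕ [] t fzero) empty₀
  ; ends-empty = trans (at (fromℕ m) (toℕ-fromℕ m)) emptyₘ
  ; rowOrHook = λ i i≤m → subst RowOrHook (sym (at (fromℕ< (s≤s i≤m)) (toℕ-fromℕ< (s≤s i≤m)))) (rowOrHook _)
  ; oscStep = λ i i<m → subst₂ OscStep (sym (at-inject₁ i<m)) (sym (at-suc i<m)) (steps (fromℕ< i<m))
  ; noHookGrowth = λ i i<m k 1≤k hook hook′ →
      noHookGrowth (fromℕ< i<m) k 1≤k (trans (sym (at-inject₁ i<m)) hook) (trans (sym (at-suc i<m)) hook′) }
  where
  at : ∀ {i} (j : Fin (suc m)) → toℕ j ≡ i → lookupℕ [] t i ≡ lookup t j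
  at j refl = lookupℕ-toℕ [] t j
  at-inject₁ : ∀ {i} (i<m : i < m) → lookupℕ [] t i ≡ lookup t (inject₁ (fromℕ< i<m))
  at-inject₁ i<m = at _ (trans (toℕ-inject₁ _) (toℕ-fromℕ< i<m))
  at-suc : ∀ {i} (i<m : i < m) → lookupℕ [] t (suc i) ≡ lookup t (fsuc (fromℕ< i<m))
  at-suc i<m = at (fsuc _) (cong suc (toℕ-fromℕ< i<m))

fromℕ-or : {k : ℕ} → Fin k → ℕ → Fin k
fromℕ-or {k} d x with x <? k
... | yes x<k = fromℕ< x<k
... | no _ = d

toℕ-fromℕ-or : ∀ {k} (d : Fin k) {x} → x < k → toℕ (fromℕ-or d x) ≡ x
toℕ-fromℕ-or {k} d {x} x<k with x <? k
... | yes x<k′ = toℕ-fromℕ< x<k′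
... | no x≮k = contradiction x<k x≮k

-- The default i is never used when P maps positions below m below m.
vectorOf : {m : ℕ} → (ℕ → ℕ) → Vec (Fin m) m
vectorOf P = tabulate λ i → fromℕ-or i (P (toℕ i))

module _ {m : ℕ} {P : ℕ → ℕ} (M : IsMatchingOn m P) where
  open IsMatchingOn M

  toℕ-lookup-vectorOf : ∀ i → toℕ (lookup (vectorOf P) i) ≡ P (toℕ i)
  toℕ-lookup-vectorOf i = trans (cong toℕ (VecP.lookup∘tabulate _ i)) (toℕ-fromℕ-or i (partner<m (toℕ i) (toℕ<n i)))

  vectorOf-agrees : ∀ x → x < m → CanonicalForm.P (vectorOf {m} P) x ≡ P x
  vectorOf-agrees x x<m = trans (CanonicalForm.P-fromℕ< (vectorOf {m} P) x<m)
                                (trans (toℕ-lookup-vectorOf (fromℕ< x<m)) (cong P (toℕ-fromℕ< x<m)))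

  vectorOf-isMatching : IsMatching (vectorOf {m} P)
  vectorOf-isMatching =
    (λ i → toℕ-injective (trans (toℕ-lookup-vectorOf _)
             (trans (cong P (toℕ-lookup-vectorOf i)) (involutive (toℕ i) (toℕ<n i))))) ,
    (λ i eq → fixpoint-free (toℕ i) (toℕ<n i) (trans (sym (toℕ-lookup-vectorOf i)) (cong toℕ eq)))

module Bijection (m : ℕ) where

  tableauOf : Vec (Fin m) m → Vec (List ℕ) (suc m)
  tableauOf p = tabulateℕ (Tableau.shapeAt m (CanonicalForm.P p))

  tableauOf-restricted : ∀ p → MatchingAvoiding12312 m p → RestrictedTableauVec m (tableauOf p)
  tableauOf-restricted p valid = tabulateℕ-restricted (AvoidingMatching.shapeAt-restricted p valid)

  tableauOf-injective : ∀ p q → MatchingAvoiding12312 m p → MatchingAvoiding12312 m q → tableauOf p ≡ tableauOf q → p ≡ q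
  tableauOf-injective p q valid-p valid-q same =
    lookup-extensionality p q λ i → toℕ-injective (begin
      toℕ (lookup p i) ≡⟨ CanonicalForm.P-toℕ p i ⟨
      P (toℕ i)        ≡⟨ partners-agree (toℕ i) (toℕ<n i) ⟩
      Q (toℕ i)        ≡⟨ CanonicalForm.P-toℕ q i ⟩
      toℕ (lookup q i) ∎)
    where
    open ≡-Reasoning
    module A = AvoidingMatching p valid-p
    module B = AvoidingMatching q valid-q
    P = CanonicalForm.P p
    Q = CanonicalForm.P q
    module TP = Tableau m P
    module TQ = Tableau m Q
    sameShape : ∀ i → i ≤ m → TP.shapeAt i ≡ TQ.shapeAt i
    sameShape i i≤m = trans (sym (lookupℕ-tabulateℕ [] TP.shapeAt (s≤s i≤m)))
                        (trans (cong (λ t → lookupℕ [] t i) same) (lookupℕ-tabulateℕ [] TQ.shapeAt (s≤s i≤m)))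
    sameCount : ∀ i → i ≤ m → TP.openCount i ≡ TQ.openCount i
    sameCount i i≤m = proj₁ (shape-injective (A.hookFits i) (B.hookFits i) (sameShape i i≤m))
    sameHook : ∀ i → i < m → does (TP.crossed? i) ≡ does (TQ.crossed? i)
    sameHook i i<m = proj₂ (shape-injective (A.hookFits i) (B.hookFits i) (sameShape i (<⇒≤ i<m)))
    open Uniqueness m P Q A.isMatchingOn B.isMatchingOn A.avoids B.avoids sameCount sameHook

  decode : Vec (List ℕ) (suc m) → Vec (Fin m) m
  decode t = vectorOf (Decoding.decoded m (lookupℕ [] t))

  module _ (t : Vec (List ℕ) (suc m)) (valid : RestrictedTableauVec m t) where
    private
      R = lookupℕ-restricted t valid
      D = Decoding.decoded m (lookupℕ [] t)
      M = Decoding.decoded-isMatching m (lookupℕ [] t) R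

    decode-valid : MatchingAvoiding12312 m (decode t)
    decode-valid = vectorOf-isMatching M , λ contains →
      Decoded.decoded-avoids R (occurrence-transfer (vectorOf-agrees M)
        (Pattern12312.contains⇒occurrence (decode t) (vectorOf-isMatching M) contains))

    tableauOf-decode : tableauOf (decode t) ≡ t
    tableauOf-decode = lookup-extensionality _ t λ i → begin
      lookup (tableauOf (decode t)) i               ≡⟨ lookup-tabulateℕ (Tableau.shapeAt m (CanonicalForm.P (decode t))) i ⟩
      Tableau.shapeAt m (CanonicalForm.P (decode t)) (toℕ i) ≡⟨ shapeAt-cong (vectorOf-agrees M) (toℕ i) ⟩
      Tableau.shapeAt m D (toℕ i)                   ≡⟨ Decoded.shapeAt-decoded R (toℕ i) (≤-pred (toℕ<n i)) ⟩
      lookupℕ [] t (toℕ i)                          ≡⟨ lookupℕ-toℕ [] t i ⟩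
      lookup t i                                    ∎
      where open ≡-Reasoning

  bijection : Refinement (Vec (Fin m) m) (MatchingAvoiding12312 m) ⤖ Refinement (Vec (List ℕ) (suc m)) (RestrictedTableauVec m)
  bijection = mk⤖ {to = to} (injective , surjective)
    where
    to = Refinement.map tableauOf (λ {p} → tableauOf-restricted p)
    injective : ∀ {x y} → to x ≡ to y → x ≡ y
    injective {p , [ valid-p ]} {q , [ valid-q ]} same =
      value-injective (recompute (VecP.≡-dec FinP._≟_ p q) (tableauOf-injective p q valid-p valid-q (cong value same)))
    surjective : ∀ y → ∃ λ x → ∀ {z} → z ≡ x → to z ≡ y
    surjective (t , [ valid ]) = (decode t , [ decode-valid t valid ]) ,
      λ { refl → value-injective (recompute (VecP.≡-dec (ListP.≡-dec _≟_) (tableauOf (decode t)) t) (tableauOf-decode t valid)) }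

-- The bijection exists for n = 0 as well.
theorem4 : (n : ℕ) → 1 ≤ n → Avoiding12312 n ⤖ RestrictedTableaux n
theorem4 n _ = Bijection.bijection (2 * n)
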